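{- Let $C=(S,F)$ be a $5$-dimensional cap and let $(x_1,x_2)$ be any independent pair of co-ordinates of $F$. Then the $3$-flat point count of $C$ for $(x_1,x_2)$ is neither of the forms (where $*$ denotes an arbitrary entry) \[\begin{pmatrix}8&*&5\\ 1&6&*\\ 8&*&5\end{pmatrix}\quad\text{nor}\quad\begin{pmatrix}8&*&6\\ 1&5&*\\ 8&*&6\end{pmatrix}.\]
   Context: An $n$-flat is an $n$-dimensional affine space over $\mathbb{Z}/3\mathbb{Z}$; a line is a set $\{p,p+v,p+2v\}$ with $v\ne0$. A $5$-dimensional cap is a pair $(S,F)$ with $F$ a $5$-flat and $S\subseteq F$ containing no three collinear points (cap points). A co-ordinate of $F$ is a nonconstant affine map $F\to\mathbb{Z}/3\mathbb{Z}$; a pair $(x_1,x_2)$ of co-ordinates is independent if their linear parts are linearly independent, so that each set $\{x_1=i,x_2=j\}$ ($i,j\in\{ -1,0,1\}$) is a $3$-flat. Writing $n_{i,j}=|S\cap\{x_1=i,\,x_2=j\}|$, the $3$-flat point count of $C$ for $(x_1,x_2)$ is the matrix \[\begin{pmatrix}n_{ -1,1}&n_{0,1}&n_{1,1}\\ n_{ -1,0}&n_{0,0}&n_{1,0}\\ n_{ -1,-1}&n_{0,-1}&n_{1,-1}\end{pmatrix}.\] -}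

module Defs where

open import Data.Fin using (Fin; zero; suc)
open import Data.Nat using (ℕ)
open import Data.Bool using (Bool; true; false; _∧_)
open import Data.Vec using (Vec; []; _∷_; zipWith; replicate; foldr)
open import Data.List using (List; []; _∷_; concatMap; length)
import Data.List as L
open import Data.Product using (_×_)
open import Relation.Binary.PropositionalEquality using (_≡_; _≢_)
open import Relation.Nullary using (¬_)
open import Relation.Nullary.Decidable using (⌊_⌋)
import Data.Fin.Properties as FinP

-- ℤ/3ℤ : elements 0, 1, 2 ; the element 2 plays the role of -1

Z3 : Set
Z3 = Fin 3

z0 z1 zm1 : Z3
z0 = zero
z1 = suc zero
zm1 = suc (suc zero)

infixl 6 _+₃_
infixl 7 _*₃_

_+₃_ : Z3 → Z3 → Z3
zero +₃ y = y
suc zero +₃ zero = suc zero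
suc zero +₃ suc zero = suc (suc zero)
suc zero +₃ suc (suc zero) = zero
suc (suc zero) +₃ zero = suc (suc zero)
suc (suc zero) +₃ suc zero = zero
suc (suc zero) +₃ suc (suc zero) = suc zero

_*₃_ : Z3 → Z3 → Z3
zero *₃ y = zero
suc zero *₃ y = y
suc (suc zero) *₃ zero = zero
suc (suc zero) *₃ suc zero = suc (suc zero)
suc (suc zero) *₃ suc (suc zero) = suc zero

-- The 5-flat F, realised as the affine space (ℤ/3ℤ)^5
-- (every 5-flat is affinely isomorphic to it).

Pt : Set
Pt = Vec Z3 5

infixl 6 _⊕_
infixr 7 _·_

_⊕_ : Pt → Pt → Pt
_⊕_ = zipWith _+₃_

_·_ : Z3 → Pt → Pt
c · v = Data.Vec.map (c *₃_) v

zeroPt : Pt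
zeroPt = replicate 5 z0

dot : ∀ {n} → Vec Z3 n → Vec Z3 n → Z3
dot a p = foldr (λ _ → Z3) _+₃_ z0 (zipWith _*₃_ a p)

allVecs : (n : ℕ) → List (Vec Z3 n)
allVecs ℕ.zero = [] ∷ []
allVecs (ℕ.suc n) =
  concatMap (λ v → (z0 ∷ v) ∷ (z1 ∷ v) ∷ (zm1 ∷ v) ∷ []) (allVecs n)

allPts : List Pt
allPts = allVecs 5

Line⊆ : (Pt → Bool) → Pt → Pt → Set
Line⊆ S p v = (S p ≡ true) × (S (p ⊕ v) ≡ true) × (S (p ⊕ (z1 +₃ z1) · v) ≡ true)

IsCap : (Pt → Bool) → Set
IsCap S = ∀ (p v : Pt) → v ≢ zeroPt → ¬ Line⊆ S p v

-- Co-ordinates: affine maps F → ℤ/3ℤ, x(p) = dot a p + c, nonconstant iff a ≠ 0.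

record Coord : Set where
  constructor coord
  field
    lin   : Pt
    const : Z3
    nonconst : lin ≢ zeroPt

evalC : Coord → Pt → Z3
evalC x p = dot (Coord.lin x) p +₃ Coord.const x

Independent : Coord → Coord → Set
Independent x y =
  ∀ (λ₁ λ₂ : Z3) →
    (λ₁ · Coord.lin x) ⊕ (λ₂ · Coord.lin y) ≡ zeroPt → (λ₁ ≡ z0) × (λ₂ ≡ z0)

count : (Pt → Bool) → Coord → Coord → Z3 → Z3 → ℕ
count S x y i j =
  length (L.filterᵇ (λ p → S p ∧ ⌊ evalC x p FinP.≟ i ⌋ ∧ ⌊ evalC y p FinP.≟ j ⌋ )
                   allPts)

-- Choose a 2 × 2 minor of the linear parts of x₁ and x₂ that is nonzero.  Deleting its two
-- coordinates identifies every 3-flat {x₁ = i, x₂ = j} with 𝔽₃³ by one linear map, and three cap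
-- points taken from three 3-flats on a line of the 3 × 3 grid never sum to zero.  An affine change of coordinates
-- puts 0, e₁, e₂, e₃ into O and 0 into D and E, after which O contains an affine image of one of a
-- few representative caps.  For each representative an exhaustive search lists every 8-cap that A
-- can be, given a cap E ∋ 0 of the prescribed size with no a + o + e = 0, and likewise for C and D.
-- Any two candidates A₁, C₁ satisfy a + q + c = 0 for every q with suitable a ∈ A₁, c ∈ C₁, so the
-- point of B would be collinear with a point of A and a point of C.

module Submission where

open import Defs
open import Data.Bool using (Bool; true; false; T; not; _∧_; if_then_else_)
open import Data.Bool.ListAction using (all; any)
open import Data.Bool.Properties using (T-≡; T-∧; T-not-≡)
open import Data.Empty using (⊥; ⊥-elim)
open import Data.Fin using (Fin; zero; suc; punchOut; #_)
open import Data.Fin.Properties using (all?; any?) renaming (_≟_ to _≟₃_)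
open import Data.List using (List; []; _∷_; length; filter; filterᵇ; map; _++_; take; drop; deduplicate)
import Data.List.Properties as List
open import Data.List.Properties using (filter-notAll; length-map; length-take; filter-accept; filter-none; length-filter)
open import Data.List.Membership.Propositional using (_∈_; _∉_; lose; find)
open import Data.List.Membership.Propositional.Properties
  using (∈-filter⁺; ∈-filter⁻; ∈-map⁻; ∈-concatMap⁺; ∈-++⁺ˡ; ∈-++⁺ʳ; ∈-deduplicate⁺)
open import Data.List.Relation.Binary.Sublist.Propositional using (_⊆_; []; _∷_; _∷ʳ_; ⊆-refl; ⊆-trans)
import Data.List.Relation.Binary.Sublist.Propositional as Sublist
open import Data.List.Relation.Binary.Sublist.Propositional.Properties using (length-mono-≤; take-⊆; filter-⊆; filter⁺)
open import Data.List.Relation.Unary.All as All using (All; []; _∷_)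
import Data.List.Relation.Unary.All.Properties as All
import Data.List.Relation.Unary.AllPairs as AllPairs
open import Data.List.Relation.Unary.Any as Any using (Any; here; there; satisfied)
import Data.List.Relation.Unary.Any.Properties as Any
open import Data.List.Relation.Unary.Unique.Propositional using (Unique; []; _∷_)
open import Data.List.Relation.Unary.Unique.Propositional.Properties
  using (map⁺; take⁺; drop⁺) renaming (filter⁺ to unique-filter⁺)
open import Data.List.Relation.Unary.Unique.DecPropositional using (unique?)
open import Data.Nat using (ℕ; zero; suc; _≤_; _<_; _<ᵇ_; _+_; _∸_; z≤n; s≤s; _≤?_)
open import Data.Nat.DivMod using (_mod_)
open import Data.Nat.Properties
  using (module ≤-Reasoning; ≤-trans; ≤-pred; ≤-reflexive; <⇒≱; ≰⇒>; <ᵇ⇒<; suc-injective; +-suc; +-monoˡ-≤;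
         +-cancelˡ-≤; m≤n⇒m⊓n≡m; m≤n+o⇒m∸n≤o)
open import Data.Product using (_×_; _,_; proj₁; proj₂; ∃; ∃₂; Σ-syntax; uncurry)
open import Data.Sum using (_⊎_; inj₁; inj₂; [_,_]′)
open import Data.Vec using (Vec; []; _∷_; zipWith; replicate; lookup; removeAt; updateAt)
import Data.Vec as Vec
open import Data.Vec.Properties
  using (zipWith-comm; zipWith-assoc; zipWith-identityˡ; zipWith-identityʳ; zipWith-inverseʳ; ≡-dec; ∷-injective;
         lookup-zipWith; lookup-map; lookup-replicate; lookup∘updateAt; lookup∘updateAt′; removeAt-punchOut)
open import Function using (_∘_; Equivalence)
open import Relation.Binary.Definitions using (DecidableEquality)
open import Relation.Binary.PropositionalEquality
open import Relation.Nullary using (¬_; Dec; yes; no; does; contradiction)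
open import Relation.Nullary.Decidable
  using (from-yes; ¬?; _→-dec_; _×-dec_; decidable-stable; ⌊_⌋; toWitness; fromWitness; dec-true; dec-false; T?)
import Relation.Nullary.Decidable as Dec

private
  variable
    n sO sE : ℕ

-- 𝔽₃ and 𝔽₃ⁿ

infix 8 -₃_

-₃_ : Z3 → Z3
-₃ zero = zero
-₃ suc zero = suc (suc zero)
-₃ suc (suc zero) = suc zero

+₃-identityʳ : ∀ x → x +₃ z0 ≡ x
+₃-identityʳ = from-yes (all? λ x → x +₃ z0 ≟₃ x)

+₃-comm : ∀ x y → x +₃ y ≡ y +₃ x
+₃-comm = from-yes (all? λ x → all? λ y → x +₃ y ≟₃ y +₃ x)

+₃-assoc : ∀ x y z → (x +₃ y) +₃ z ≡ x +₃ (y +₃ z)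
+₃-assoc = from-yes (all? λ x → all? λ y → all? λ z → (x +₃ y) +₃ z ≟₃ x +₃ (y +₃ z))

+₃-inverseʳ : ∀ x → x +₃ -₃ x ≡ z0
+₃-inverseʳ = from-yes (all? λ x → x +₃ -₃ x ≟₃ z0)

+₃-triple : ∀ x → x +₃ x +₃ x ≡ z0
+₃-triple = from-yes (all? λ x → x +₃ x +₃ x ≟₃ z0)

+₃-exchange : ∀ x y z → x +₃ (y +₃ z) ≡ y +₃ (x +₃ z)
+₃-exchange = from-yes (all? λ x → all? λ y → all? λ z → x +₃ (y +₃ z) ≟₃ y +₃ (x +₃ z))

*₃-distrib-+₃ : ∀ c x y s t → c *₃ (x +₃ y) +₃ (s +₃ t) ≡ (c *₃ x +₃ s) +₃ (c *₃ y +₃ t)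
*₃-distrib-+₃ = from-yes (all? λ c → all? λ x → all? λ y → all? λ s → all? λ t →
  c *₃ (x +₃ y) +₃ (s +₃ t) ≟₃ (c *₃ x +₃ s) +₃ (c *₃ y +₃ t))

*₃-zeroʳ : ∀ x → x *₃ z0 ≡ z0
*₃-zeroʳ = from-yes (all? λ x → x *₃ z0 ≟₃ z0)

infixl 6 _⊞_
infix 8 ⊟_
infixr 7 _⊙_

_⊞_ : Vec Z3 n → Vec Z3 n → Vec Z3 n
_⊞_ = zipWith _+₃_

⊟_ : Vec Z3 n → Vec Z3 n
⊟_ = Vec.map -₃_

𝟎 : Vec Z3 n
𝟎 = replicate _ z0

_⊙_ : Z3 → Vec Z3 n → Vec Z3 n
c ⊙ v = Vec.map (c *₃_) v

⊞-comm : (u v : Vec Z3 n) → u ⊞ v ≡ v ⊞ u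
⊞-comm = zipWith-comm +₃-comm

⊞-assoc : (u v w : Vec Z3 n) → u ⊞ v ⊞ w ≡ u ⊞ (v ⊞ w)
⊞-assoc = zipWith-assoc +₃-assoc

⊞-identityˡ : (u : Vec Z3 n) → 𝟎 ⊞ u ≡ u
⊞-identityˡ = zipWith-identityˡ λ _ → refl

⊞-identityʳ : (u : Vec Z3 n) → u ⊞ 𝟎 ≡ u
⊞-identityʳ = zipWith-identityʳ +₃-identityʳ

⊞-inverseʳ : (u : Vec Z3 n) → u ⊞ ⊟ u ≡ 𝟎
⊞-inverseʳ = zipWith-inverseʳ +₃-inverseʳ

⊞-triple : (u : Vec Z3 n) → u ⊞ u ⊞ u ≡ 𝟎
⊞-triple [] = refl
⊞-triple (x ∷ u) = cong₂ _∷_ (+₃-triple x) (⊞-triple u)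

⊞-cancelʳ : (u v w : Vec Z3 n) → u ⊞ w ≡ v ⊞ w → u ≡ v
⊞-cancelʳ u v w eq = begin
  u                ≡⟨ cancel u ⟨
  u ⊞ w ⊞ ⊟ w      ≡⟨ cong (_⊞ ⊟ w) eq ⟩
  v ⊞ w ⊞ ⊟ w      ≡⟨ cancel v ⟩
  v                ∎
  where
  open ≡-Reasoning
  cancel : ∀ x → x ⊞ w ⊞ ⊟ w ≡ x
  cancel x = trans (⊞-assoc x w (⊟ w)) (trans (cong (x ⊞_) (⊞-inverseʳ w)) (⊞-identityʳ x))

⊟-sum : ∀ (u v : Vec Z3 n) → ⊟ (u ⊞ v) ⊞ u ⊞ v ≡ 𝟎
⊟-sum [] [] = refl
⊟-sum (x ∷ u) (y ∷ v) = cong₂ _∷_ (law x y) (⊟-sum u v)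
  where
  law : ∀ x y → -₃ (x +₃ y) +₃ x +₃ y ≡ z0
  law = from-yes (all? λ x → all? λ y → -₃ (x +₃ y) +₃ x +₃ y ≟₃ z0)

⊟-middle : ∀ (u v : Vec Z3 n) → u ⊞ ⊟ (u ⊞ v) ⊞ v ≡ 𝟎
⊟-middle [] [] = refl
⊟-middle (x ∷ u) (y ∷ v) = cong₂ _∷_ (law x y) (⊟-middle u v)
  where
  law : ∀ x y → x +₃ -₃ (x +₃ y) +₃ y ≡ z0
  law = from-yes (all? λ x → all? λ y → x +₃ -₃ (x +₃ y) +₃ y ≟₃ z0)

⊟-cancelʳ : ∀ (u v : Vec Z3 n) → u ⊞ ⊟ v ⊞ v ≡ u
⊟-cancelʳ [] [] = refl
⊟-cancelʳ (x ∷ u) (y ∷ v) = cong₂ _∷_ (law x y) (⊟-cancelʳ u v)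
  where
  law : ∀ x y → x +₃ -₃ y +₃ y ≡ x
  law = from-yes (all? λ x → all? λ y → x +₃ -₃ y +₃ y ≟₃ x)

diff-sum : ∀ {n} (a b c : Vec Z3 n) → (b ⊞ ⊟ a) ⊞ (c ⊞ ⊟ a) ≡ a ⊞ b ⊞ c
diff-sum [] [] [] = refl
diff-sum (x ∷ a) (y ∷ b) (z ∷ c) = cong₂ _∷_ (law x y z) (diff-sum a b c)
  where
  law : ∀ x y z → (y +₃ -₃ x) +₃ (z +₃ -₃ x) ≡ x +₃ y +₃ z
  law = from-yes (all? λ x → all? λ y → all? λ z → (y +₃ -₃ x) +₃ (z +₃ -₃ x) ≟₃ x +₃ y +₃ z)

diff≡𝟎 : ∀ {n} (u v : Vec Z3 n) → u ⊞ ⊟ v ≡ 𝟎 → u ≡ v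
diff≡𝟎 u v eq = trans (sym (⊟-cancelʳ u v)) (trans (cong (_⊞ v) eq) (⊞-identityˡ v))

line-point₂ : ∀ (u v : Vec Z3 n) → u ⊞ (v ⊞ u ⊞ u) ≡ v
line-point₂ [] [] = refl
line-point₂ (x ∷ u) (y ∷ v) = cong₂ _∷_ (law x y) (line-point₂ u v)
  where
  law : ∀ x y → x +₃ (y +₃ x +₃ x) ≡ y
  law = from-yes (all? λ x → all? λ y → x +₃ (y +₃ x +₃ x) ≟₃ y)

line-point₃ : ∀ (u v w : Vec Z3 n) → u ⊞ v ⊞ w ≡ 𝟎 → u ⊞ (z1 +₃ z1) ⊙ (v ⊞ u ⊞ u) ≡ w
line-point₃ [] [] [] _ = refl
line-point₃ (x ∷ u) (y ∷ v) (z ∷ w) eq =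
  cong₂ _∷_ (law x y z (proj₁ (∷-injective eq))) (line-point₃ u v w (proj₂ (∷-injective eq)))
  where
  law : ∀ x y z → x +₃ y +₃ z ≡ z0 → x +₃ (z1 +₃ z1) *₃ (y +₃ x +₃ x) ≡ z
  law = from-yes (all? λ x → all? λ y → all? λ z → (x +₃ y +₃ z ≟₃ z0) →-dec (x +₃ (z1 +₃ z1) *₃ (y +₃ x +₃ x) ≟₃ z))

⊙-distribʳ : ∀ a b (u : Vec Z3 n) → (a +₃ b) ⊙ u ≡ a ⊙ u ⊞ b ⊙ u
⊙-distribʳ a b [] = refl
⊙-distribʳ a b (x ∷ u) = cong₂ _∷_ (law a b x) (⊙-distribʳ a b u)
  where
  law : ∀ a b x → (a +₃ b) *₃ x ≡ a *₃ x +₃ b *₃ x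
  law = from-yes (all? λ a → all? λ b → all? λ x → (a +₃ b) *₃ x ≟₃ a *₃ x +₃ b *₃ x)

⊙-zeroˡ : ∀ (u : Vec Z3 n) → z0 ⊙ u ≡ 𝟎
⊙-zeroˡ [] = refl
⊙-zeroˡ (x ∷ u) = cong (z0 ∷_) (⊙-zeroˡ u)

⊙-identityˡ : ∀ (u : Vec Z3 n) → z1 ⊙ u ≡ u
⊙-identityˡ [] = refl
⊙-identityˡ (x ∷ u) = cong (x ∷_) (⊙-identityˡ u)

⊞-shuffle : ∀ (a b c d e f : Vec Z3 n) → (a ⊞ b) ⊞ (c ⊞ d) ⊞ (e ⊞ f) ≡ (a ⊞ c ⊞ e) ⊞ (b ⊞ d ⊞ f)
⊞-shuffle [] [] [] [] [] [] = refl
⊞-shuffle (a ∷ as) (b ∷ bs) (c ∷ cs) (d ∷ ds) (e ∷ es) (f ∷ fs) =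
  cong₂ _∷_ (law a b c d e f) (⊞-shuffle as bs cs ds es fs)
  where
  law : ∀ a b c d e f → (a +₃ b) +₃ (c +₃ d) +₃ (e +₃ f) ≡ (a +₃ c +₃ e) +₃ (b +₃ d +₃ f)
  law = from-yes (all? λ a → all? λ b → all? λ c → all? λ d → all? λ e → all? λ f →
    (a +₃ b) +₃ (c +₃ d) +₃ (e +₃ f) ≟₃ (a +₃ c +₃ e) +₃ (b +₃ d +₃ f))

dot-⊞ : ∀ (a u v : Vec Z3 n) → dot a (u ⊞ v) ≡ dot a u +₃ dot a v
dot-⊞ [] [] [] = refl
dot-⊞ (c ∷ a) (x ∷ u) (y ∷ v) =
  trans (cong (c *₃ (x +₃ y) +₃_) (dot-⊞ a u v)) (*₃-distrib-+₃ c x y (dot a u) (dot a v))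

dot-𝟎 : ∀ (a : Vec Z3 n) → dot a 𝟎 ≡ z0
dot-𝟎 [] = refl
dot-𝟎 (c ∷ a) rewrite dot-𝟎 a = trans (+₃-identityʳ (c *₃ z0)) (*₃-zeroʳ c)

dot-removeAt : ∀ (a z : Vec Z3 (suc n)) i →
  dot a z ≡ lookup a i *₃ lookup z i +₃ dot (removeAt a i) (removeAt z i)
dot-removeAt (c ∷ a) (x ∷ z) zero = refl
dot-removeAt (c ∷ a@(_ ∷ _)) (x ∷ z@(_ ∷ _)) (suc i) =
  trans (cong (c *₃ x +₃_) (dot-removeAt a z i)) 
    (+₃-exchange (c *₃ x) (lookup a i *₃ lookup z i) (dot (removeAt a i) (removeAt z i)))

removeAt-⊞ : ∀ (u v : Vec Z3 (suc n)) i → removeAt (u ⊞ v) i ≡ removeAt u i ⊞ removeAt v i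
removeAt-⊞ (x ∷ u) (y ∷ v) zero = refl
removeAt-⊞ (x ∷ u@(_ ∷ _)) (y ∷ v@(_ ∷ _)) (suc i) = cong (x +₃ y ∷_) (removeAt-⊞ u v i)

removeAt≡𝟎 : ∀ (z : Vec Z3 (suc n)) i → lookup z i ≡ z0 → removeAt z i ≡ 𝟎 → z ≡ 𝟎
removeAt≡𝟎 (x ∷ z) zero x≡0 z≡𝟎 = cong₂ _∷_ x≡0 z≡𝟎
removeAt≡𝟎 (x ∷ z@(_ ∷ _)) (suc i) zi≡0 eq =
  cong₂ _∷_ (proj₁ (∷-injective eq)) (removeAt≡𝟎 z i zi≡0 (proj₂ (∷-injective eq)))

infix 4 _≟ᵥ_

_≟ᵥ_ : DecidableEquality (Vec Z3 n)
_≟ᵥ_ = ≡-dec _≟₃_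

∈-allVecs : ∀ (v : Vec Z3 n) → v ∈ allVecs n
∈-allVecs [] = here refl
∈-allVecs (x ∷ v) = ∈-concatMap⁺ _ (Any.map (λ { refl → ∈-extensions x }) (∈-allVecs v))
  where
  ∈-extensions : ∀ x → x ∷ v ∈ (z0 ∷ v) ∷ (z1 ∷ v) ∷ (zm1 ∷ v) ∷ []
  ∈-extensions zero = here refl
  ∈-extensions (suc zero) = there (here refl)
  ∈-extensions (suc (suc zero)) = there (there (here refl))

T-∧⁻ : ∀ x {y} → T (x ∧ y) → T x × T y
T-∧⁻ true h = _ , h

T-not⁺ : ∀ b → ¬ T b → T (not b)
T-not⁺ false _ = _
T-not⁺ true ¬b = ¬b _

T-not⁻ : ∀ b → T (not b) → ¬ T b
T-not⁻ true ()

¬T⇒≡false : ∀ b → ¬ T b → b ≡ false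
¬T⇒≡false false _ = refl
¬T⇒≡false true ¬b = contradiction _ ¬b

≤⇒<ᵇ≡false : ∀ {m n} → n ≤ m → (m <ᵇ n) ≡ false
≤⇒<ᵇ≡false {m} {n} n≤m = ¬T⇒≡false (m <ᵇ n) λ h → <⇒≱ (<ᵇ⇒< m n h) n≤m

map⁺-unique : ∀ {A B : Set} (f : A → B) {xs : List A} →
  (∀ {x y} → x ∈ xs → y ∈ xs → f x ≡ f y → x ≡ y) → Unique xs → Unique (map f xs)
map⁺-unique f inj [] = []
map⁺-unique f inj (x∉xs ∷ uxs) =
  All.map⁺ (All.tabulate λ y∈xs fx≡fy → All.lookup x∉xs y∈xs (inj (here refl) (there y∈xs) fx≡fy))
  ∷ map⁺-unique f (λ x∈ y∈ → inj (there x∈) (there y∈)) uxs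

module _ {A : Set} (_≟_ : DecidableEquality A) where

  unique-length-≤ : ∀ {xs ys : List A} → Unique xs → (∀ {x} → x ∈ xs → x ∈ ys) → length xs ≤ length ys
  unique-length-≤ [] _ = z≤n
  unique-length-≤ {x ∷ xs} {ys} (x∉xs ∷ uxs) xs⊆ys =
    ≤-trans (s≤s (unique-length-≤ uxs λ y∈xs → ∈-filter⁺ (λ y → ¬? (x ≟ y)) (xs⊆ys (there y∈xs)) (All.lookup x∉xs y∈xs)))
            (filter-notAll (λ y → ¬? (x ≟ y)) ys (Any.map (λ x≡y x≢y → x≢y x≡y) (xs⊆ys (here refl))))

  module _ {xs : List A} (xs-complete : ∀ x → x ∈ xs) (xs-unique : Unique xs) where

    injective⇒surjective : ∀ {f : A → A} → (∀ {x y} → f x ≡ f y → x ≡ y) → ∀ y → ∃ λ x → f x ≡ y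
    injective⇒surjective {f} inj y with Any.any? (λ x → f x ≟ y) xs
    ... | yes hit = Any.satisfied hit
    ... | no miss = contradiction (subst (_≤ length (filter (λ z → ¬? (y ≟ z)) xs)) (length-map f xs) fxs≤)
                                  (<⇒≱ (filter-notAll (λ z → ¬? (y ≟ z)) xs (Any.map (λ y≡z y≢z → y≢z y≡z) (xs-complete y))))
      where
      fxs≤ : length (map f xs) ≤ length (filter (λ z → ¬? (y ≟ z)) xs)
      fxs≤ = unique-length-≤ (map⁺ inj xs-unique) λ {z} z∈fxs →
        let (x , x∈xs , z≡fx) = ∈-map⁻ f z∈fxs
        in ∈-filter⁺ (λ z → ¬? (y ≟ z)) (xs-complete z) λ y≡z → miss (lose x∈xs (trans (sym z≡fx) (sym y≡z)))

module _ {A B : Set} (_≟_ : DecidableEquality B) (f : A → B) {P : A → Bool} {Q : B → Bool}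
         {xs : List A} {ys : List B} where

  length-filter-≤ : Unique xs → (∀ y → y ∈ ys) →
    (∀ {x y} → T (P x) → T (P y) → f x ≡ f y → x ≡ y) → (∀ {x} → T (P x) → T (Q (f x))) →
    length (filterᵇ P xs) ≤ length (filterᵇ Q ys)
  length-filter-≤ xs-unique ys-complete inj P⇒Q =
    subst (_≤ length (filterᵇ Q ys)) (length-map f (filterᵇ P xs))
      (unique-length-≤ _≟_ (map⁺-unique f (λ x∈ y∈ → inj (P-of x∈) (P-of y∈)) (unique-filter⁺ (T? ∘ P) xs-unique)) λ {y} y∈ →
        let (x , x∈ , y≡fx) = ∈-map⁻ f y∈
        in ∈-filter⁺ (T? ∘ Q) (ys-complete y) (subst (T ∘ Q) (sym y≡fx) (P⇒Q (P-of x∈))))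
    where
    P-of : ∀ {x} → x ∈ filterᵇ P xs → T (P x)
    P-of x∈ = proj₂ (∈-filter⁻ (T? ∘ P) {xs = xs} x∈)

length-filter-split : ∀ {A : Set} (p q : A → Bool) xs →
  length (filterᵇ p xs) ≡ length (filterᵇ p (filterᵇ q xs)) + length (filterᵇ p (filterᵇ (not ∘ q) xs))
length-filter-split p q [] = refl
length-filter-split p q (x ∷ xs) with q x
... | true with p x
...   | true = cong suc (length-filter-split p q xs)
...   | false = length-filter-split p q xs
length-filter-split p q (x ∷ xs) | false with p x
...   | true = trans (cong suc (length-filter-split p q xs)) (sym (+-suc _ _))
...   | false = length-filter-split p q xs

filterᵇ-⊆ : ∀ {A : Set} {X Y : A → Bool} → (∀ {w} → T (X w) → T (Y w)) → ∀ xs → filterᵇ X xs ⊆ filterᵇ Y xs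
filterᵇ-⊆ {X = X} {Y} X⇒Y xs = filter⁺ (T? ∘ X) (T? ∘ Y) (λ { refl → X⇒Y }) (⊆-refl {x = xs})

element : ∀ {A : Set} (X : A → Bool) xs → 1 ≤ length (filterᵇ X xs) → ∃ λ x → x ∈ xs × T (X x)
element X xs 1≤ with Any.any? (T? ∘ X) xs
... | yes hit = find hit
... | no miss = contradiction (subst (λ ys → 1 ≤ length ys) (filter-none (T? ∘ X) (All.¬Any⇒All¬ xs miss)) 1≤) λ ()

three-distinct : ∀ {A : Set} {xs : List A} → Unique xs → 3 ≤ length xs →
  ∃₂ λ a b → ∃ λ c → a ∈ xs × b ∈ xs × c ∈ xs × a ≢ b × a ≢ c × b ≢ c
three-distinct {xs = a ∷ b ∷ c ∷ _} ((a≢b ∷ a≢c ∷ _) ∷ (b≢c ∷ _) ∷ _) (s≤s (s≤s (s≤s z≤n))) =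
  a , b , c , here refl , there (here refl) , there (there (here refl)) , a≢b , a≢c , b≢c

module _ {A : Set} (X : A → Bool) (k : ℕ) (xs : List A) where

  someOf : List A
  someOf = take k (filterᵇ X xs)

  someOf-⊆ : someOf ⊆ filterᵇ X xs
  someOf-⊆ = take-⊆ k (filterᵇ X xs)

  someOf-length : k ≤ length (filterᵇ X xs) → length someOf ≡ k
  someOf-length k≤ = trans (length-take k (filterᵇ X xs)) (m≤n⇒m⊓n≡m k≤)

  someOf-unique : Unique xs → Unique someOf
  someOf-unique uxs = take⁺ k (unique-filter⁺ (T? ∘ X) uxs)

  someOf-⊆X : All (T ∘ X) someOf
  someOf-⊆X = All.take⁺ k (All.all-filter (T? ∘ X) xs)

-- Caps and a projection of 𝔽₃ⁿ⁺² onto 𝔽₃ⁿ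

Cap : (Vec Z3 n → Bool) → Set
Cap X = ∀ {u v w} → u ≢ v → u ⊞ v ⊞ w ≡ 𝟎 → T (X u) → T (X v) → T (X w) → ⊥

isCap⇒Cap : ∀ {S} → IsCap S → Cap S
isCap⇒Cap {S} cap {u} {v} {w} u≢v sum≡𝟎 Su Sv Sw =
  cap u (v ⊞ u ⊞ u) step≢𝟎
    (≡true Su , subst (λ p → S p ≡ true) (sym (line-point₂ u v)) (≡true Sv) ,
     subst (λ p → S p ≡ true) (sym (line-point₃ u v w sum≡𝟎)) (≡true Sw))
  where
  ≡true : ∀ {b} → T b → b ≡ true
  ≡true = Equivalence.to T-≡
  step≢𝟎 : v ⊞ u ⊞ u ≢ 𝟎
  step≢𝟎 eq = u≢v (sym (⊞-cancelʳ v u u (⊞-cancelʳ (v ⊞ u) (u ⊞ u) u (trans eq (sym (⊞-triple u))))))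

minor : Vec Z3 n → Vec Z3 n → Fin n → Fin n → Z3
minor a b i k = lookup a i *₃ lookup b k +₃ -₃ (lookup a k *₃ lookup b i)

minor-diag : ∀ (a b : Vec Z3 n) i → minor a b i i ≡ z0
minor-diag a b i = +₃-inverseʳ (lookup a i *₃ lookup b i)

minor≢0⇒≢ : ∀ (a b : Vec Z3 n) {i k} → minor a b i k ≢ z0 → i ≢ k
minor≢0⇒≢ a b {i} m≢0 refl = m≢0 (minor-diag a b i)

lookup-combination : ∀ c d (a b : Vec Z3 n) k → lookup (c ⊙ a ⊞ d ⊙ b) k ≡ c *₃ lookup a k +₃ d *₃ lookup b k
lookup-combination c d a b k =
  trans (lookup-zipWith _+₃_ k (c ⊙ a) (d ⊙ b)) (cong₂ _+₃_ (lookup-map k (c *₃_) a) (lookup-map k (d *₃_) b))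

≡𝟎-by-lookup : ∀ (v : Vec Z3 n) → (∀ i → lookup v i ≡ z0) → v ≡ 𝟎
≡𝟎-by-lookup [] _ = refl
≡𝟎-by-lookup (x ∷ v) v≡𝟎 = cong₂ _∷_ (v≡𝟎 zero) (≡𝟎-by-lookup v (v≡𝟎 ∘ suc))

LinearlyIndependent : Vec Z3 n → Vec Z3 n → Set
LinearlyIndependent a b = ∀ λ₁ λ₂ → λ₁ ⊙ a ⊞ λ₂ ⊙ b ≡ 𝟎 → λ₁ ≡ z0 × λ₂ ≡ z0

-- If every 2 × 2 minor vanishes then a_i b - b_i a = 0 for each i, forcing a = 0.
independent⇒minor≢0 : ∀ {a b : Vec Z3 n} → LinearlyIndependent a b → ∃₂ λ i k → minor a b i k ≢ z0
independent⇒minor≢0 {a = a} {b} indep with any? (λ i → any? λ k → ¬? (minor a b i k ≟₃ z0))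
... | yes (i , k , m≢0) = i , k , m≢0
... | no none = contradiction (proj₁ (indep z1 z0 (≡𝟎-by-lookup _ λ k →
                  trans (lookup-combination z1 z0 a b k) (trans (+₃-identityʳ _) (a≡𝟎 k))))) λ ()
  where
  minor≡0 : ∀ i k → minor a b i k ≡ z0
  minor≡0 i k = decidable-stable (minor a b i k ≟₃ z0) λ m≢0 → none (i , k , m≢0)
  swap-law : ∀ x y z w → -₃ y *₃ z +₃ x *₃ w ≡ x *₃ w +₃ -₃ (z *₃ y)
  swap-law = from-yes (all? λ x → all? λ y → all? λ z → all? λ w →
    -₃ y *₃ z +₃ x *₃ w ≟₃ x *₃ w +₃ -₃ (z *₃ y))
  a≡𝟎 : ∀ i → lookup a i ≡ z0
  a≡𝟎 i = proj₂ (indep (-₃ lookup b i) (lookup a i) (≡𝟎-by-lookup _ λ k →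
    trans (lookup-combination (-₃ lookup b i) (lookup a i) a b k)
          (trans (swap-law (lookup a i) (lookup b i) (lookup a k) (lookup b k)) (minor≡0 i k))))

det≢0⇒trivial-kernel : ∀ a c b d x y → a *₃ d +₃ -₃ (c *₃ b) ≢ z0 →
  a *₃ x +₃ c *₃ y ≡ z0 → b *₃ x +₃ d *₃ y ≡ z0 → x ≡ z0 × y ≡ z0
det≢0⇒trivial-kernel = from-yes (all? λ a → all? λ c → all? λ b → all? λ d → all? λ x → all? λ y →
  ¬? (a *₃ d +₃ -₃ (c *₃ b) ≟₃ z0) →-dec ((a *₃ x +₃ c *₃ y ≟₃ z0) →-dec
    ((b *₃ x +₃ d *₃ y ≟₃ z0) →-dec ((x ≟₃ z0) ×-dec (y ≟₃ z0)))))

dropPair : ∀ {i k : Fin (suc (suc n))} → i ≢ k → Vec Z3 (suc (suc n)) → Vec Z3 n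
dropPair {i = i} i≢k z = removeAt (removeAt z i) (punchOut i≢k)

dropPair-⊞ : ∀ {i k : Fin (suc (suc n))} (i≢k : i ≢ k) u v → dropPair i≢k (u ⊞ v) ≡ dropPair i≢k u ⊞ dropPair i≢k v
dropPair-⊞ {i = i} i≢k u v = trans (cong (λ w → removeAt w (punchOut i≢k)) (removeAt-⊞ u v i))
                                   (removeAt-⊞ (removeAt u i) (removeAt v i) (punchOut i≢k))

dot-dropPair≡𝟎 : ∀ {i k : Fin (suc (suc n))} (i≢k : i ≢ k) c z → dropPair i≢k z ≡ 𝟎 →
  dot c z ≡ lookup c i *₃ lookup z i +₃ lookup c k *₃ lookup z k
dot-dropPair≡𝟎 {i = i} {k} i≢k c z dz≡𝟎 = begin
  dot c z
    ≡⟨ dot-removeAt c z i ⟩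
  lookup c i *₃ lookup z i +₃ dot (removeAt c i) (removeAt z i)
    ≡⟨ cong (lookup c i *₃ lookup z i +₃_) (dot-removeAt (removeAt c i) (removeAt z i) (punchOut i≢k)) ⟩
  lookup c i *₃ lookup z i +₃ (lookup (removeAt c i) (punchOut i≢k) *₃ lookup (removeAt z i) (punchOut i≢k)
                               +₃ dot (dropPair i≢k c) (dropPair i≢k z))
    ≡⟨ cong₂ (λ x y → lookup c i *₃ lookup z i +₃ (x +₃ y))
             (cong₂ _*₃_ (removeAt-punchOut c i≢k) (removeAt-punchOut z i≢k))
             (trans (cong (dot (dropPair i≢k c)) dz≡𝟎) (dot-𝟎 (dropPair i≢k c))) ⟩
  lookup c i *₃ lookup z i +₃ (lookup c k *₃ lookup z k +₃ z0)
    ≡⟨ cong (lookup c i *₃ lookup z i +₃_) (+₃-identityʳ _) ⟩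
  lookup c i *₃ lookup z i +₃ lookup c k *₃ lookup z k ∎
  where open ≡-Reasoning

dropPair-kernel : ∀ {a b : Vec Z3 (suc (suc n))} {i k} (i≢k : i ≢ k) → minor a b i k ≢ z0 →
  ∀ z → dot a z ≡ z0 → dot b z ≡ z0 → dropPair i≢k z ≡ 𝟎 → z ≡ 𝟎
dropPair-kernel {a = a} {b} {i} {k} i≢k m≢0 z az≡0 bz≡0 dz≡𝟎 =
  removeAt≡𝟎 z i (proj₁ zi,zk≡0) (removeAt≡𝟎 (removeAt z i) (punchOut i≢k)
    (trans (removeAt-punchOut z i≢k) (proj₂ zi,zk≡0)) dz≡𝟎)
  where
  zi,zk≡0 : lookup z i ≡ z0 × lookup z k ≡ z0
  zi,zk≡0 = det≢0⇒trivial-kernel (lookup a i) (lookup a k) (lookup b i) (lookup b k) (lookup z i) (lookup z k) m≢0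
              (trans (sym (dot-dropPair≡𝟎 i≢k a z dz≡𝟎)) az≡0) (trans (sym (dot-dropPair≡𝟎 i≢k b z dz≡𝟎)) bz≡0)

-- The configuration in 𝔽₃³

Pt₃ : Set
Pt₃ = Vec Z3 3

points : List Pt₃
points = allVecs 3

points-unique : Unique points
points-unique = from-yes (unique? _≟ᵥ_ points)

points≡𝟎∷nonzero : points ≡ 𝟎 ∷ drop 1 points
points≡𝟎∷nonzero = refl

∣_∣ : (Pt₃ → Bool) → ℕ
∣ X ∣ = length (filterᵇ X points)

SumFree : (X Y Z : Pt₃ → Bool) → Set
SumFree X Y Z = ∀ {x y z} → x ⊞ y ⊞ z ≡ 𝟎 → T (X x) → T (Y y) → T (Z z) → ⊥

-- The sets are the images in 𝔽₃³ of the cap points in the 3-flats {x₁ = i, x₂ = j} laid out as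
--   A · D
--   B O ·
--   C · E
-- so that A O E, C O D and A B C are lines of the 3 × 3 grid.
record Config (sO sE : ℕ) : Set where
  field
    A B C O D E : Pt₃ → Bool
    cap-A : Cap A
    cap-C : Cap C
    cap-O : Cap O
    cap-D : Cap D
    cap-E : Cap E
    sumFree-AOE : SumFree A O E
    sumFree-COD : SumFree C O D
    sumFree-ABC : SumFree A B C
    8≤∣A∣ : 8 ≤ ∣ A ∣
    1≤∣B∣ : 1 ≤ ∣ B ∣
    8≤∣C∣ : 8 ≤ ∣ C ∣
    sO≤∣O∣ : sO ≤ ∣ O ∣
    sE≤∣D∣ : sE ≤ ∣ D ∣
    sE≤∣E∣ : sE ≤ ∣ E ∣

evalC-sum : ∀ (x : Coord) p p' p'' → evalC x p +₃ evalC x p' +₃ evalC x p'' ≡ z0 →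
  dot (Coord.lin x) (p ⊞ p' ⊞ p'') ≡ z0
evalC-sum (coord a c _) p p' p'' sum≡0 = begin
  dot a (p ⊞ p' ⊞ p'')                         ≡⟨ trans (dot-⊞ a (p ⊞ p') p'') (cong (_+₃ dot a p'') (dot-⊞ a p p')) ⟩
  dot a p +₃ dot a p' +₃ dot a p''             ≡⟨ law (dot a p) (dot a p') (dot a p'') c ⟨
  (dot a p +₃ c) +₃ (dot a p' +₃ c) +₃ (dot a p'' +₃ c) ≡⟨ sum≡0 ⟩
  z0                                           ∎
  where
  open ≡-Reasoning
  law : ∀ x y z c → (x +₃ c) +₃ (y +₃ c) +₃ (z +₃ c) ≡ x +₃ y +₃ z
  law = from-yes (all? λ x → all? λ y → all? λ z → all? λ c → (x +₃ c) +₃ (y +₃ c) +₃ (z +₃ c) ≟₃ x +₃ y +₃ z)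

module Cells (S : Pt → Bool) (cap : Cap S) (x₁ x₂ : Coord) {i k : Fin 5} (i≢k : i ≢ k)
             (m≢0 : minor (Coord.lin x₁) (Coord.lin x₂) i k ≢ z0) where

  π : Pt → Pt₃
  π = dropPair i≢k

  InCell : Z3 → Z3 → Pt → Bool
  InCell s t p = S p ∧ ⌊ evalC x₁ p ≟₃ s ⌋ ∧ ⌊ evalC x₂ p ≟₃ t ⌋

  image : Z3 → Z3 → Pt₃ → Bool
  image s t v = any (λ p → InCell s t p ∧ ⌊ π p ≟ᵥ v ⌋) allPts

  inCell⁻ : ∀ {s t p} → T (InCell s t p) → T (S p) × evalC x₁ p ≡ s × evalC x₂ p ≡ t
  inCell⁻ {s} {t} {p} h with T-∧⁻ (S p) h
  ... | Sp , h' = Sp , toWitness (proj₁ (T-∧⁻ ⌊ evalC x₁ p ≟₃ s ⌋ h')) , toWitness (proj₂ (T-∧⁻ ⌊ evalC x₁ p ≟₃ s ⌋ h'))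

  image⁻ : ∀ {s t v} → T (image s t v) → ∃ λ p → T (InCell s t p) × π p ≡ v
  image⁻ {s} {t} {v} h with satisfied (Any.any⁻ (λ p → InCell s t p ∧ ⌊ π p ≟ᵥ v ⌋) allPts h)
  ... | p , h' = p , proj₁ (T-∧⁻ (InCell s t p) h') , toWitness (proj₂ (T-∧⁻ (InCell s t p) h'))

  image⁺ : ∀ {s t p} → T (InCell s t p) → T (image s t (π p))
  image⁺ {s} {t} {p} h = Any.any⁺ (λ q → InCell s t q ∧ ⌊ π q ≟ᵥ π p ⌋) (lose (∈-allVecs p) (Equivalence.from T-∧ (h , fromWitness refl)))

  sum≡𝟎 : ∀ {p p' p''} → evalC x₁ p +₃ evalC x₁ p' +₃ evalC x₁ p'' ≡ z0 →
    evalC x₂ p +₃ evalC x₂ p' +₃ evalC x₂ p'' ≡ z0 → π p ⊞ π p' ⊞ π p'' ≡ 𝟎 → p ⊞ p' ⊞ p'' ≡ 𝟎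
  sum≡𝟎 {p} {p'} {p''} h₁ h₂ hπ = dropPair-kernel {a = Coord.lin x₁} {b = Coord.lin x₂} i≢k m≢0 (p ⊞ p' ⊞ p'')
    (evalC-sum x₁ p p' p'' h₁) (evalC-sum x₂ p p' p'' h₂)
    (trans (trans (dropPair-⊞ i≢k (p ⊞ p') p'') (cong (_⊞ π p'') (dropPair-⊞ i≢k p p'))) hπ)

  π-injective-on-cells : ∀ {s t p p'} → T (InCell s t p) → T (InCell s t p') → π p ≡ π p' → p ≡ p'
  π-injective-on-cells {s} {t} {p} {p'} h h' πp≡πp' with inCell⁻ h | inCell⁻ h'
  ... | _ , e₁ , e₂ | _ , e₁' , e₂' =
    ⊞-cancelʳ p p' p' (⊞-cancelʳ (p ⊞ p') (p' ⊞ p') p' (trans p+p'+p'≡𝟎 (sym (⊞-triple p'))))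
    where
    p+p'+p'≡𝟎 : p ⊞ p' ⊞ p' ≡ 𝟎
    p+p'+p'≡𝟎 = sum≡𝟎 (trans (cong₂ (λ x y → x +₃ y +₃ y) e₁ e₁') (+₃-triple s))
                      (trans (cong₂ (λ x y → x +₃ y +₃ y) e₂ e₂') (+₃-triple t))
                      (trans (cong (λ v → v ⊞ π p' ⊞ π p') πp≡πp') (⊞-triple (π p')))

  no-sum≡𝟎 : ∀ {s s' s'' t t' t'' u u' u''} → s +₃ s' +₃ s'' ≡ z0 → t +₃ t' +₃ t'' ≡ z0 →
    u ≢ u' ⊎ s ≢ s' ⊎ t ≢ t' → u ⊞ u' ⊞ u'' ≡ 𝟎 →
    T (image s t u) → T (image s' t' u') → T (image s'' t'' u'') → ⊥
  no-sum≡𝟎 hs ht distinct sum Xu Xu' Xu'' with image⁻ Xu | image⁻ Xu' | image⁻ Xu''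
  ... | p , hp , refl | p' , hp' , refl | p'' , hp'' , refl with inCell⁻ hp | inCell⁻ hp' | inCell⁻ hp''
  ... | Sp , refl , refl | Sp' , refl , refl | Sp'' , refl , refl =
    cap p≢p' (sum≡𝟎 hs ht sum) Sp Sp' Sp''
    where
    p≢p' : p ≢ p'
    p≢p' refl = [ (λ ne → ne refl) , [ (λ ne → ne refl) , (λ ne → ne refl) ]′ ]′ distinct

  image-cap : ∀ s t → Cap (image s t)
  image-cap s t u≢u' = no-sum≡𝟎 (+₃-triple s) (+₃-triple t) (inj₁ u≢u')

  image-sumFree : ∀ s t s' t' s'' t'' → s +₃ s' +₃ s'' ≡ z0 → t +₃ t' +₃ t'' ≡ z0 → s ≢ s' ⊎ t ≢ t' →
    SumFree (image s t) (image s' t') (image s'' t'')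
  image-sumFree _ _ _ _ _ _ hs ht distinct = no-sum≡𝟎 hs ht (inj₂ distinct)

  image-size : ∀ s t {m} → m ≤ count S x₁ x₂ s t → m ≤ ∣ image s t ∣
  image-size s t m≤count = ≤-trans m≤count
    (length-filter-≤ _≟ᵥ_ π {P = InCell s t} {Q = image s t} allPts-unique ∈-allVecs π-injective-on-cells image⁺)
    where
    allPts-unique : Unique allPts
    allPts-unique = from-yes (unique? _≟ᵥ_ allPts)

  config : ∀ {sO sE} →
    8 ≤ count S x₁ x₂ zm1 z1 → 1 ≤ count S x₁ x₂ zm1 z0 → 8 ≤ count S x₁ x₂ zm1 zm1 →
    sO ≤ count S x₁ x₂ z0 z0 → sE ≤ count S x₁ x₂ z1 z1 → sE ≤ count S x₁ x₂ z1 zm1 → Config sO sE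
  config nA nB nC nO nD nE = record
    { A = image zm1 z1 ; B = image zm1 z0 ; C = image zm1 zm1
    ; O = image z0 z0 ; D = image z1 z1 ; E = image z1 zm1
    ; cap-A = image-cap zm1 z1 ; cap-C = image-cap zm1 zm1 ; cap-O = image-cap z0 z0
    ; cap-D = image-cap z1 z1 ; cap-E = image-cap z1 zm1
    ; sumFree-AOE = image-sumFree zm1 z1 z0 z0 z1 zm1 refl refl (inj₁ λ ())
    ; sumFree-COD = image-sumFree zm1 zm1 z0 z0 z1 z1 refl refl (inj₁ λ ())
    ; sumFree-ABC = image-sumFree zm1 z1 zm1 z0 zm1 zm1 refl refl (inj₂ λ ())
    ; 8≤∣A∣ = image-size zm1 z1 nA
    ; 1≤∣B∣ = image-size zm1 z0 nB
    ; 8≤∣C∣ = image-size zm1 zm1 nC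
    ; sO≤∣O∣ = image-size z0 z0 nO
    ; sE≤∣D∣ = image-size z1 z1 nD
    ; sE≤∣E∣ = image-size z1 zm1 nE
    }

config : ∀ {S sO sE} → IsCap S → ∀ x₁ x₂ → Independent x₁ x₂ →
  8 ≤ count S x₁ x₂ zm1 z1 → 1 ≤ count S x₁ x₂ zm1 z0 → 8 ≤ count S x₁ x₂ zm1 zm1 →
  sO ≤ count S x₁ x₂ z0 z0 → sE ≤ count S x₁ x₂ z1 z1 → sE ≤ count S x₁ x₂ z1 zm1 → Config sO sE
config {S} cap x₁ x₂ indep =
  let (_ , _ , m≢0) = independent⇒minor≢0 indep
  in Cells.config S (isCap⇒Cap cap) x₁ x₂ (minor≢0⇒≢ (Coord.lin x₁) (Coord.lin x₂) m≢0) m≢0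

-- Affine maps of 𝔽₃³

record Matrix : Set where
  constructor matrix
  field
    col₁ col₂ col₃ : Pt₃

infixr 8 _∙_

_∙_ : Matrix → Pt₃ → Pt₃
matrix c₁ c₂ c₃ ∙ (w₁ ∷ w₂ ∷ w₃ ∷ []) = w₁ ⊙ c₁ ⊞ w₂ ⊙ c₂ ⊞ w₃ ⊙ c₃

e₁ e₂ e₃ : Pt₃
e₁ = z1 ∷ z0 ∷ z0 ∷ []

e₂ = z0 ∷ z1 ∷ z0 ∷ []

e₃ = z0 ∷ z0 ∷ z1 ∷ []

∙-⊞ : ∀ M u v → M ∙ (u ⊞ v) ≡ M ∙ u ⊞ M ∙ v
∙-⊞ (matrix c₁ c₂ c₃) (u₁ ∷ u₂ ∷ u₃ ∷ []) (v₁ ∷ v₂ ∷ v₃ ∷ []) =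
  trans (cong₂ _⊞_ (cong₂ _⊞_ (⊙-distribʳ u₁ v₁ c₁) (⊙-distribʳ u₂ v₂ c₂)) (⊙-distribʳ u₃ v₃ c₃))
        (⊞-shuffle (u₁ ⊙ c₁) (v₁ ⊙ c₁) (u₂ ⊙ c₂) (v₂ ⊙ c₂) (u₃ ⊙ c₃) (v₃ ⊙ c₃))

∙-𝟎 : ∀ M → M ∙ 𝟎 ≡ 𝟎
∙-𝟎 (matrix c₁ c₂ c₃)
  rewrite ⊙-zeroˡ c₁ | ⊙-zeroˡ c₂ | ⊙-zeroˡ c₃ | ⊞-identityˡ (𝟎 {3}) = ⊞-identityˡ 𝟎

∙𝟎⊞ : ∀ M t → M ∙ 𝟎 ⊞ t ≡ t
∙𝟎⊞ M t = trans (cong (_⊞ t) (∙-𝟎 M)) (⊞-identityˡ t)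

∙-e₁ : ∀ x u v → matrix x u v ∙ e₁ ≡ x
∙-e₁ x u v rewrite ⊙-identityˡ x | ⊙-zeroˡ u | ⊙-zeroˡ v | ⊞-identityʳ x = ⊞-identityʳ x

∙-e₂ : ∀ x u v → matrix x u v ∙ e₂ ≡ u
∙-e₂ x u v rewrite ⊙-zeroˡ x | ⊙-identityˡ u | ⊙-zeroˡ v | ⊞-identityˡ u = ⊞-identityʳ u

∙-e₃ : ∀ x u v → matrix x u v ∙ e₃ ≡ v
∙-e₃ x u v rewrite ⊙-zeroˡ x | ⊙-zeroˡ u | ⊙-identityˡ v | ⊞-identityˡ (𝟎 {3}) = ⊞-identityˡ v

Nonsingular : Matrix → Set
Nonsingular M = ∀ w → M ∙ w ≡ 𝟎 → w ≡ 𝟎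

nonsingular? : ∀ M → Dec.Dec (Nonsingular M)
nonsingular? M = Dec.map′ (λ h w → All.lookup h (∈-allVecs w)) (λ h → All.tabulate λ {w} _ → h w)
                          (All.all? (λ w → (M ∙ w ≟ᵥ 𝟎) →-dec (w ≟ᵥ 𝟎)) points)

affine : Matrix → Pt₃ → Pt₃ → Pt₃
affine M t w = M ∙ w ⊞ t

affine-sum : ∀ M t t' t'' u v w → affine M t u ⊞ affine M t' v ⊞ affine M t'' w ≡ M ∙ (u ⊞ v ⊞ w) ⊞ (t ⊞ t' ⊞ t'')
affine-sum M t t' t'' u v w = trans (⊞-shuffle (M ∙ u) t (M ∙ v) t' (M ∙ w) t'')
  (cong (_⊞ (t ⊞ t' ⊞ t'')) (sym (trans (∙-⊞ M (u ⊞ v) w) (cong (_⊞ M ∙ w) (∙-⊞ M u v)))))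

module _ {M : Matrix} (M-nonsingular : Nonsingular M) where

  affine-injective : ∀ t {u v} → affine M t u ≡ affine M t v → u ≡ v
  affine-injective t {u} {v} eq =
    ⊞-cancelʳ u v v (⊞-cancelʳ (u ⊞ v) (v ⊞ v) v (trans (M-nonsingular (u ⊞ v ⊞ v) M∙≡𝟎) (sym (⊞-triple v))))
    where
    Mu≡Mv : M ∙ u ≡ M ∙ v
    Mu≡Mv = ⊞-cancelʳ (M ∙ u) (M ∙ v) t eq
    M∙≡𝟎 : M ∙ (u ⊞ v ⊞ v) ≡ 𝟎
    M∙≡𝟎 = trans (trans (∙-⊞ M (u ⊞ v) v) (cong (_⊞ M ∙ v) (∙-⊞ M u v)))
                 (trans (cong (λ x → x ⊞ M ∙ v ⊞ M ∙ v) Mu≡Mv) (⊞-triple (M ∙ v)))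

  cap-pullback : ∀ t {X} → Cap X → Cap (X ∘ affine M t)
  cap-pullback t capX {u} {v} {w} u≢v sum≡𝟎 =
    capX (u≢v ∘ affine-injective t)
      (trans (affine-sum M t t t u v w) (trans (cong₂ _⊞_ (trans (cong (M ∙_) sum≡𝟎) (∙-𝟎 M)) (⊞-triple t)) (⊞-identityʳ 𝟎)))

  size-pullback : ∀ t X → ∣ X ∣ ≤ ∣ X ∘ affine M t ∣
  size-pullback t X =
    length-filter-≤ _≟ᵥ_ preimage {P = X} {Q = X ∘ affine M t} points-unique ∈-allVecs
      (λ {y} {y'} _ _ eq → trans (sym (preimage-sound y)) (trans (cong (affine M t) eq) (preimage-sound y')))
      (λ {y} Xy → subst (T ∘ X) (sym (preimage-sound y)) Xy)
    where
    surjective : ∀ y → ∃ λ w → affine M t w ≡ y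
    surjective = injective⇒surjective _≟ᵥ_ ∈-allVecs points-unique (affine-injective t)
    preimage : Pt₃ → Pt₃
    preimage y = proj₁ (surjective y)
    preimage-sound : ∀ y → affine M t (preimage y) ≡ y
    preimage-sound y = proj₂ (surjective y)

sumFree-pullback : ∀ M {tX tY tZ X Y Z} → tX ⊞ tY ⊞ tZ ≡ 𝟎 → SumFree X Y Z →
  SumFree (X ∘ affine M tX) (Y ∘ affine M tY) (Z ∘ affine M tZ)
sumFree-pullback M {tX} {tY} {tZ} t-sum sumFree {x} {y} {z} sum≡𝟎 =
  sumFree (trans (affine-sum M tX tY tZ x y z)
                 (trans (cong₂ _⊞_ (trans (cong (M ∙_) sum≡𝟎) (∙-𝟎 M)) t-sum) (⊞-identityʳ 𝟎)))

-- Each set is moved by w ↦ M w + t with translations summing to zero along each line of the grid.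
pullback : ∀ {sO sE} → Config sO sE → (M : Matrix) → Nonsingular M → (tO tD tE : Pt₃) → Config sO sE
pullback c M M-ns tO tD tE = record
  { A = A ∘ affine M tA ; B = B ∘ affine M tB ; C = C ∘ affine M tC
  ; O = O ∘ affine M tO ; D = D ∘ affine M tD ; E = E ∘ affine M tE
  ; cap-A = cap-pullback M-ns tA cap-A
  ; cap-C = cap-pullback M-ns tC cap-C
  ; cap-O = cap-pullback M-ns tO cap-O
  ; cap-D = cap-pullback M-ns tD cap-D
  ; cap-E = cap-pullback M-ns tE cap-E
  ; sumFree-AOE = sumFree-pullback M (⊟-sum tO tE) sumFree-AOE
  ; sumFree-COD = sumFree-pullback M (⊟-sum tO tD) sumFree-COD
  ; sumFree-ABC = sumFree-pullback M (⊟-middle tA tC) sumFree-ABC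
  ; 8≤∣A∣ = ≤-trans 8≤∣A∣ (size-pullback M-ns tA A)
  ; 1≤∣B∣ = ≤-trans 1≤∣B∣ (size-pullback M-ns tB B)
  ; 8≤∣C∣ = ≤-trans 8≤∣C∣ (size-pullback M-ns tC C)
  ; sO≤∣O∣ = ≤-trans sO≤∣O∣ (size-pullback M-ns tO O)
  ; sE≤∣D∣ = ≤-trans sE≤∣D∣ (size-pullback M-ns tD D)
  ; sE≤∣E∣ = ≤-trans sE≤∣E∣ (size-pullback M-ns tE E)
  }
  where
  open Config c
  tA tB tC : Pt₃
  tA = ⊟ (tO ⊞ tE)
  tC = ⊟ (tO ⊞ tD)
  tB = ⊟ (tA ⊞ tC)

∈-pullback : ∀ {X : Pt₃ → Bool} M t w {p} → M ∙ w ⊞ t ≡ p → T (X p) → T ((X ∘ affine M t) w)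
∈-pullback {X} M t w eq Xp = subst (T ∘ X) (sym eq) Xp

-- Enumerating caps

third : Pt₃ → Pt₃ → Pt₃
third a b = ⊟ (a ⊞ b)

third-sum : ∀ a b → a ⊞ b ⊞ third a b ≡ 𝟎
third-sum a b = ⊞-inverseʳ (a ⊞ b)

third-sum′ : ∀ e o → third e o ⊞ o ⊞ e ≡ 𝟎
third-sum′ e o = begin
  ⊟ (e ⊞ o) ⊞ o ⊞ e    ≡⟨ ⊞-assoc (⊟ (e ⊞ o)) o e ⟩
  ⊟ (e ⊞ o) ⊞ (o ⊞ e)  ≡⟨ cong (⊟ (e ⊞ o) ⊞_) (⊞-comm o e) ⟩
  ⊟ (e ⊞ o) ⊞ (e ⊞ o)  ≡⟨ ⊞-comm (⊟ (e ⊞ o)) (e ⊞ o) ⟩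
  (e ⊞ o) ⊞ ⊟ (e ⊞ o)  ≡⟨ ⊞-inverseʳ (e ⊞ o) ⟩
  𝟎                    ∎
  where open ≡-Reasoning

infix 4 _==_

_==_ : Pt₃ → Pt₃ → Bool
u == v = does (u ≟ᵥ v)

==-complete : ∀ {u v} → u ≡ v → T (u == v)
==-complete {u} {v} u≡v = subst T (sym (dec-true (u ≟ᵥ v) u≡v)) _

==-sound : ∀ {u v} → T (u == v) → u ≡ v
==-sound {u} {v} h with u ≟ᵥ v
... | yes u≡v = u≡v

extendsCap : List Pt₃ → Pt₃ → Bool
extendsCap [] x = true
extendsCap (a ∷ as) x = all (λ b → not (x == third a b)) as ∧ extendsCap as x

-- The caps ac ∪ ys for ys a k-element sublist of xs, where m is the length of xs.
capExtensions : ℕ → ℕ → List Pt₃ → List Pt₃ → List (List Pt₃)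
capExtensions zero m ac xs = ac ∷ []
capExtensions (suc k) m ac [] = []
capExtensions (suc k) zero ac (x ∷ xs) = []
capExtensions (suc k) (suc m) ac (x ∷ xs) =
  if m <ᵇ k then [] else ((if extendsCap ac x then capExtensions k m (x ∷ ac) xs else []) ++ capExtensions (suc k) m ac xs)

extendsCap-complete : ∀ {X} → Cap X → ∀ {ac x} → Unique ac → All (T ∘ X) ac → T (X x) → T (extendsCap ac x)
extendsCap-complete capX [] [] Xx = _
extendsCap-complete capX {a ∷ as} {x} (a∉as ∷ uas) (Xa ∷ Xas) Xx =
  Equivalence.from T-∧
    (All.all⁻ _ (All.tabulate λ {b} b∈as → Equivalence.from T-not-≡ (dec-false (x ≟ᵥ third a b) λ x≡ →
       capX (All.lookup a∉as b∈as) (subst (λ w → a ⊞ b ⊞ w ≡ 𝟎) (sym x≡) (third-sum a b)) Xa (All.lookup Xas b∈as) Xx)) ,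
     extendsCap-complete capX uas Xas Xx)

capExtensions-complete : ∀ {X} → Cap X → ∀ k ac {xs ys} → ys ⊆ xs → length ys ≡ k →
  Unique ys → Unique ac → (∀ {y} → y ∈ ys → y ∉ ac) → All (T ∘ X) ys → All (T ∘ X) ac →
  ∃ λ R → R ∈ capExtensions k (length xs) ac xs × All (T ∘ X) R
capExtensions-complete capX zero ac _ _ _ _ _ _ Xac = ac , here refl , Xac
capExtensions-complete capX (suc k) ac [] () _ _ _ _ _
capExtensions-complete capX (suc k) ac {x ∷ xs} {ys} ys⊆ len uys uac disj Xys Xac
  rewrite ≤⇒<ᵇ≡false (≤-pred (subst (_≤ suc (length xs)) len (length-mono-≤ ys⊆)))
  with ys⊆
... | .x ∷ʳ ys⊆xs with capExtensions-complete capX (suc k) ac ys⊆xs len uys uac disj Xys Xac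
...   | R , R∈ , XR = R , ∈-++⁺ʳ _ R∈ , XR
capExtensions-complete capX (suc k) ac {x ∷ xs} {x ∷ ys} ys⊆ len (x∉ys ∷ uys) uac disj (Xx ∷ Xys) Xac | refl ∷ ys⊆xs
  rewrite Equivalence.to T-≡ (extendsCap-complete capX uac Xac Xx)
  with capExtensions-complete capX k (x ∷ ac) ys⊆xs (suc-injective len) uys
         (All.tabulate (λ x∈ac x≡ → disj (here refl) (subst (_∈ ac) (sym x≡) x∈ac)) ∷ uac)
         (λ y∈ys → λ { (here y≡x) → All.lookup x∉ys y∈ys (sym y≡x) ; (there y∈ac) → disj (there y∈ys) y∈ac })
         Xys (Xx ∷ Xac)
... | R , R∈ , XR = R , ∈-++⁺ˡ R∈ , XR

-- Normalising the central cap

-- In 𝔽₃³ two vectors u, v are independent iff u, v, u ≠ v and u + v are nonzero.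
opaque
  extend-to-basis : ∀ u v → u ≢ 𝟎 → v ≢ 𝟎 → u ≢ v → u ⊞ v ≢ 𝟎 → ∃ λ x → Nonsingular (matrix x u v)
  extend-to-basis u v u≢𝟎 v≢𝟎 u≢v u+v≢𝟎 =
    let (x , _ , M-ns) = find (All.lookup (All.lookup table (∈-allVecs u)) (∈-allVecs v) u≢𝟎 v≢𝟎 u≢v u+v≢𝟎)
    in x , M-ns
    where
    Extendable : Pt₃ → Pt₃ → Set
    Extendable u v = u ≢ 𝟎 → v ≢ 𝟎 → u ≢ v → u ⊞ v ≢ 𝟎 → Any (λ x → Nonsingular (matrix x u v)) (e₁ ∷ e₂ ∷ e₃ ∷ [])
    table : All (λ u → All (Extendable u) points) points
    table = from-yes (All.all? (λ u → All.all? (λ v →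
      ¬? (u ≟ᵥ 𝟎) →-dec ¬? (v ≟ᵥ 𝟎) →-dec ¬? (u ≟ᵥ v) →-dec ¬? (u ⊞ v ≟ᵥ 𝟎) →-dec
        Any.any? (λ x → nonsingular? (matrix x u v)) (e₁ ∷ e₂ ∷ e₃ ∷ [])) points) points)

PlaneNormalised : Config sO sE → Set
PlaneNormalised c = T (O 𝟎) × T (O e₂) × T (O e₃) × T (D 𝟎) × T (E 𝟎)
  where open Config c

move-to-plane : (c : Config sO sE) → ∀ {o₀ o₁ o₂ d e} → let open Config c in
  o₀ ≢ o₁ → o₀ ≢ o₂ → o₁ ≢ o₂ → T (O o₀) → T (O o₁) → T (O o₂) → T (D d) → T (E e) →
  Σ[ c' ∈ Config sO sE ] PlaneNormalised c'
move-to-plane c {o₀} {o₁} {o₂} {d} {e} o₀≢o₁ o₀≢o₂ o₁≢o₂ Oo₀ Oo₁ Oo₂ Dd Ee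
  with extend-to-basis (o₁ ⊞ ⊟ o₀) (o₂ ⊞ ⊟ o₀)
         (λ u≡𝟎 → o₀≢o₁ (sym (diff≡𝟎 o₁ o₀ u≡𝟎)))
         (λ v≡𝟎 → o₀≢o₂ (sym (diff≡𝟎 o₂ o₀ v≡𝟎)))
         (λ u≡v → o₁≢o₂ (⊞-cancelʳ o₁ o₂ (⊟ o₀) u≡v))
         (λ u+v≡𝟎 → Config.cap-O c o₀≢o₁ (trans (sym (diff-sum o₀ o₁ o₂)) u+v≡𝟎) Oo₀ Oo₁ Oo₂)
... | x , M-ns =
  pullback c M M-ns o₀ d e ,
  ∈-pullback {X = O} M o₀ 𝟎 (∙𝟎⊞ M o₀) Oo₀ ,
  ∈-pullback {X = O} M o₀ e₂ (trans (cong (_⊞ o₀) (∙-e₂ x u v)) (⊟-cancelʳ o₁ o₀)) Oo₁ ,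
  ∈-pullback {X = O} M o₀ e₃ (trans (cong (_⊞ o₀) (∙-e₃ x u v)) (⊟-cancelʳ o₂ o₀)) Oo₂ ,
  ∈-pullback {X = D} M d 𝟎 (∙𝟎⊞ M d) Dd ,
  ∈-pullback {X = E} M e 𝟎 (∙𝟎⊞ M e) Ee
  where
  open Config c
  u v : Pt₃
  u = o₁ ⊞ ⊟ o₀
  v = o₂ ⊞ ⊟ o₀
  M : Matrix
  M = matrix x u v

normalise-plane : (c : Config sO sE) → 3 ≤ sO → 1 ≤ sE → Σ[ c' ∈ Config sO sE ] PlaneNormalised c'
normalise-plane c 3≤sO 1≤sE
  with three-distinct {xs = filterᵇ O points} (unique-filter⁺ (T? ∘ O) points-unique) (≤-trans 3≤sO sO≤∣O∣)
     | element D points (≤-trans 1≤sE sE≤∣D∣)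
     | element E points (≤-trans 1≤sE sE≤∣E∣)
  where open Config c
... | o₀ , o₁ , o₂ , o₀∈ , o₁∈ , o₂∈ , o₀≢o₁ , o₀≢o₂ , o₁≢o₂ | d , _ , Dd | e , _ , Ee =
  move-to-plane c o₀≢o₁ o₀≢o₂ o₁≢o₂ (O-of o₀∈) (O-of o₁∈) (O-of o₂∈) Dd Ee
  where
  open Config c
  O-of : ∀ {w} → w ∈ filterᵇ O points → T (O w)
  O-of w∈ = proj₂ (∈-filter⁻ (T? ∘ O) {xs = points} w∈)

inPlane : Pt₃ → Bool
inPlane w = does (Vec.head w ≟₃ z0)

plane : List Pt₃
plane = filterᵇ inPlane points

no-5-cap-in-plane : capExtensions 5 (length plane) [] plane ≡ []
no-5-cap-in-plane = refl

cap-in-plane : ∀ {X} → Cap X → length (filterᵇ X plane) ≤ 4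
cap-in-plane {X} capX with 5 ≤? length (filterᵇ X plane)
... | no 5≰ = ≤-pred (≰⇒> 5≰)
... | yes 5≤ with capExtensions-complete capX 5 [] {xs = plane}
                    (⊆-trans (someOf-⊆ X 5 plane) (filter-⊆ (T? ∘ X) plane))
                    (someOf-length X 5 plane 5≤) (someOf-unique X 5 plane (unique-filter⁺ (T? ∘ inPlane) points-unique))
                    [] (λ _ ()) (someOf-⊆X X 5 plane) []
...   | R , R∈ , _ = contradiction (subst (R ∈_) no-5-cap-in-plane R∈) λ ()

off-plane : ∀ {X} → Cap X → 5 ≤ ∣ X ∣ → ∃ λ w → T (X w) × Vec.head w ≢ z0
off-plane {X} capX 5≤∣X∣ = off (element X offPlane (+-cancelˡ-≤ 4 1 _ 5≤4+))
  where
  offPlane : List Pt₃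
  offPlane = filterᵇ (not ∘ inPlane) points
  5≤4+ : 5 ≤ 4 + length (filterᵇ X offPlane)
  5≤4+ = begin
    5                                                              ≤⟨ 5≤∣X∣ ⟩
    ∣ X ∣                                                          ≡⟨ length-filter-split X inPlane points ⟩
    length (filterᵇ X plane) + length (filterᵇ X offPlane)         ≤⟨ +-monoˡ-≤ _ (cap-in-plane capX) ⟩
    4 + length (filterᵇ X offPlane)                                ∎
    where open ≤-Reasoning
  off : (∃ λ w → w ∈ offPlane × T (X w)) → ∃ λ w → T (X w) × Vec.head w ≢ z0
  off (w , w∈ , Xw) = w , Xw , λ w₀≡0 →
    T-not⁻ (inPlane w) (proj₂ (∈-filter⁻ (T? ∘ (not ∘ inPlane)) {xs = points} w∈))
      (subst T (sym (dec-true (Vec.head w ≟₃ z0) w₀≡0)) _)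

opaque
  off-plane-nonsingular : ∀ w → Vec.head w ≢ z0 → Nonsingular (matrix w e₂ e₃)
  off-plane-nonsingular w w₀≢0 = All.lookup table (∈-allVecs w) w₀≢0
    where
    table : All (λ w → Vec.head w ≢ z0 → Nonsingular (matrix w e₂ e₃)) points
    table = from-yes (All.all? (λ w → ¬? (Vec.head w ≟₃ z0) →-dec nonsingular? (matrix w e₂ e₃)) points)

frame : List Pt₃
frame = e₃ ∷ e₂ ∷ e₁ ∷ 𝟎 ∷ []

Normalised : Config sO sE → Set
Normalised c = All (T ∘ O) frame × T (D 𝟎) × T (E 𝟎)
  where open Config c

move-off-plane : (c : Config sO sE) → PlaneNormalised c → (∃ λ w → T (Config.O c w) × Vec.head w ≢ z0) →
  Σ[ c' ∈ Config sO sE ] Normalised c'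
move-off-plane c (O𝟎 , Oe₂ , Oe₃ , D𝟎 , E𝟎) (w , Ow , w₀≢0) =
  pullback c M (off-plane-nonsingular w w₀≢0) 𝟎 𝟎 𝟎 ,
  (∈-pullback {X = O} M 𝟎 e₃ (trans (⊞-identityʳ _) (∙-e₃ w e₂ e₃)) Oe₃ ∷
   ∈-pullback {X = O} M 𝟎 e₂ (trans (⊞-identityʳ _) (∙-e₂ w e₂ e₃)) Oe₂ ∷
   ∈-pullback {X = O} M 𝟎 e₁ (trans (⊞-identityʳ _) (∙-e₁ w e₂ e₃)) Ow ∷
   ∈-pullback {X = O} M 𝟎 𝟎 (∙𝟎⊞ M 𝟎) O𝟎 ∷ []) ,
  ∈-pullback {X = D} M 𝟎 𝟎 (∙𝟎⊞ M 𝟎) D𝟎 ,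
  ∈-pullback {X = E} M 𝟎 𝟎 (∙𝟎⊞ M 𝟎) E𝟎
  where
  open Config c
  M : Matrix
  M = matrix w e₂ e₃

normalise : (c : Config sO sE) → 5 ≤ sO → 1 ≤ sE → Σ[ c' ∈ Config sO sE ] Normalised c'
normalise c 5≤sO 1≤sE = off-plane-step (normalise-plane c (≤-trans (s≤s (s≤s (s≤s z≤n))) 5≤sO) 1≤sE)
  where
  off-plane-step : Σ[ c₁ ∈ Config _ _ ] PlaneNormalised c₁ → Σ[ c' ∈ Config _ _ ] Normalised c'
  off-plane-step (c₁ , c₁-normal) =
    move-off-plane c₁ c₁-normal (off-plane (Config.cap-O c₁) (≤-trans 5≤sO (Config.sO≤∣O∣ c₁)))

-- The candidates for A

Grid : Set
Grid = Vec (Vec (Vec Bool 3) 3) 3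

emptyGrid : Grid
emptyGrid = replicate 3 (replicate 3 (replicate 3 false))

member : Grid → Pt₃ → Bool
member g (a ∷ b ∷ c ∷ []) = Vec.lookup (Vec.lookup (Vec.lookup g a) b) c

insert : Grid → Pt₃ → Grid
insert g (a ∷ b ∷ c ∷ []) = updateAt g a λ ga → updateAt ga b λ gab → updateAt gab c λ _ → true

insertAll : Grid → List Pt₃ → Grid
insertAll g [] = g
insertAll g (p ∷ ps) = insertAll (insert g p) ps

member-empty : ∀ w → ¬ T (member emptyGrid w)
member-empty (a ∷ b ∷ c ∷ [])
  rewrite lookup-replicate a (replicate 3 (replicate 3 false))
        | lookup-replicate b (replicate 3 false)
        | lookup-replicate c false = λ ()

member-insert : ∀ g p w → T (member (insert g p) w) → w ≡ p ⊎ T (member g w)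
member-insert g (a ∷ b ∷ c ∷ []) (a' ∷ b' ∷ c' ∷ []) h with a' ≟₃ a
... | no a'≢a = inj₂ (subst (λ ga → T (Vec.lookup (Vec.lookup ga b') c')) (lookup∘updateAt′ a' a a'≢a g) h)
... | yes refl rewrite lookup∘updateAt a' {f = λ ga → updateAt ga b λ gab → updateAt gab c λ _ → true} g
  with b' ≟₃ b
... | no b'≢b = inj₂ (subst (λ gab → T (Vec.lookup gab c')) (lookup∘updateAt′ b' b b'≢b (Vec.lookup g a')) h)
... | yes refl rewrite lookup∘updateAt b' {f = λ gab → updateAt gab c λ _ → true} (Vec.lookup g a')
  with c' ≟₃ c
... | no c'≢c = inj₂ (subst T (lookup∘updateAt′ c' c c'≢c (Vec.lookup (Vec.lookup g a') b')) h)
... | yes refl = inj₁ refl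

member-insertAll : ∀ g ps w → T (member (insertAll g ps) w) → w ∈ ps ⊎ T (member g w)
member-insertAll g [] w h = inj₂ h
member-insertAll g (p ∷ ps) w h with member-insertAll (insert g p) ps w h
... | inj₁ w∈ps = inj₁ (there w∈ps)
... | inj₂ h' with member-insert g p w h'
... | inj₁ w≡p = inj₁ (here w≡p)
... | inj₂ h'' = inj₂ h''

unblocked : Grid → List Pt₃
unblocked g = filterᵇ (not ∘ member g) points

record State : Set where
  constructor state
  field
    chosen : List Pt₃
    blockedE : Grid
    blockedA : Grid
open State

add : List Pt₃ → State → Pt₃ → State
add rep (state es bE bA) x = state (x ∷ es) (insertAll bE (map (third x) es)) (insertAll bA (map (third x) rep))

aCandidates : State → List (List Pt₃)
aCandidates s = capExtensions 8 (length free) [] free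
  where
  free : List Pt₃
  free = unblocked (blockedA s)

mutual
  search : List Pt₃ → ℕ → State → List Pt₃ → List (List Pt₃)
  search rep zero s xs = aCandidates s
  search rep (suc k) s [] = []
  search rep (suc k) s (x ∷ xs) =
    (if member (blockedE s) x then [] else continue rep k (add rep s x) xs) ++ search rep (suc k) s xs

  continue : List Pt₃ → ℕ → State → List Pt₃ → List (List Pt₃)
  continue rep k s xs = if length (unblocked (blockedA s)) <ᵇ 8 then [] else search rep k s xs

candidates : List Pt₃ → ℕ → List (List Pt₃)
candidates rep k = search rep k (add rep (state [] emptyGrid emptyGrid) 𝟎) (drop 1 points)

module CandidateSearch (rep : List Pt₃) {O E A : Pt₃ → Bool} (rep⊆O : All (T ∘ O) rep)
       (cap-E : Cap E) (cap-A : Cap A) (sumFree : SumFree A O E) (8≤∣A∣ : 8 ≤ ∣ A ∣) where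

  record Invariant (s : State) : Set where
    field
      chosen⊆E : All (T ∘ E) (chosen s)
      chosen-unique : Unique (chosen s)
      blockedE∉E : ∀ {w} → T (member (blockedE s) w) → ¬ T (E w)
      blockedA∉A : ∀ {w} → T (member (blockedA s) w) → ¬ T (A w)
  open Invariant

  initial : Invariant (state [] emptyGrid emptyGrid)
  initial = record
    { chosen⊆E = [] ; chosen-unique = []
    ; blockedE∉E = λ {w} h → contradiction h (member-empty w)
    ; blockedA∉A = λ {w} h → contradiction h (member-empty w)
    }

  add-invariant : ∀ {s x} → Invariant s → T (E x) → x ∉ chosen s → Invariant (add rep s x)
  add-invariant {s} {x} I Ex x∉ = record
    { chosen⊆E = Ex ∷ chosen⊆E I
    ; chosen-unique = All.tabulate (λ y∈ x≡y → x∉ (subst (_∈ chosen s) (sym x≡y) y∈)) ∷ chosen-unique I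
    ; blockedE∉E = λ {w} h Ew → [ (λ w∈ → let (a , a∈ , w≡) = ∈-map⁻ (third x) w∈ in
                                    cap-E (λ x≡a → x∉ (subst (_∈ chosen s) (sym x≡a) a∈))
                                          (subst (λ v → x ⊞ a ⊞ v ≡ 𝟎) (sym w≡) (third-sum x a))
                                          Ex (All.lookup (chosen⊆E I) a∈) Ew)
                                , (λ h' → blockedE∉E I h' Ew) ]′
                                (member-insertAll (blockedE s) (map (third x) (chosen s)) w h)
    ; blockedA∉A = λ {w} h Aw → [ (λ w∈ → let (o , o∈ , w≡) = ∈-map⁻ (third x) w∈ in
                                    sumFree (subst (λ v → v ⊞ o ⊞ x ≡ 𝟎) (sym w≡) (third-sum′ x o))
                                            Aw (All.lookup rep⊆O o∈) Ex)
                                , (λ h' → blockedA∉A I h' Aw) ]′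
                                (member-insertAll (blockedA s) (map (third x) rep) w h)
    }

  A⊆unblocked : ∀ {s} → Invariant s → ∀ {w} → T (A w) → T (not (member (blockedA s) w))
  A⊆unblocked {s} I {w} Aw = T-not⁺ (member (blockedA s) w) λ h → blockedA∉A I h Aw

  8≤unblocked : ∀ {s} → Invariant s → 8 ≤ length (unblocked (blockedA s))
  8≤unblocked {s} I = ≤-trans 8≤∣A∣ (length-mono-≤ (filterᵇ-⊆ (A⊆unblocked I) points))

  aCandidates-complete : ∀ {s} → Invariant s → ∃ λ R → R ∈ aCandidates s × All (T ∘ A) R
  aCandidates-complete {s} I =
    capExtensions-complete cap-A 8 []
      (⊆-trans (someOf-⊆ A 8 points) (filterᵇ-⊆ (A⊆unblocked I) points))
      (someOf-length A 8 points 8≤∣A∣) (someOf-unique A 8 points points-unique) [] (λ _ ()) (someOf-⊆X A 8 points) []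

  E-unblocked : ∀ {s x} → Invariant s → T (E x) → member (blockedE s) x ≡ false
  E-unblocked {s} {x} I Ex = ¬T⇒≡false (member (blockedE s) x) λ h → blockedE∉E I h Ex

  continue-complete : ∀ {k s xs R} → Invariant s → R ∈ search rep k s xs → R ∈ continue rep k s xs
  continue-complete {k} {s} {xs} I R∈ rewrite ≤⇒<ᵇ≡false (8≤unblocked I) = R∈

  search-complete : ∀ k {s xs ys} → Invariant s → ys ⊆ xs → length ys ≡ k → Unique ys → All (T ∘ E) ys →
    (∀ {y} → y ∈ ys → y ∉ chosen s) → ∃ λ R → R ∈ search rep k s xs × All (T ∘ A) R
  search-complete zero I _ _ _ _ _ = aCandidates-complete I
  search-complete (suc k) I [] () _ _ _
  search-complete (suc k) {s} {x ∷ xs} I (.x ∷ʳ ys⊆) len uys Eys disj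
    with search-complete (suc k) I ys⊆ len uys Eys disj
  ... | R , R∈ , AR = R , ∈-++⁺ʳ _ R∈ , AR
  search-complete (suc k) {s} {x ∷ xs} I (refl ∷ ys⊆) len (x∉ys ∷ uys) (Ex ∷ Eys) disj
    rewrite E-unblocked I Ex
    with search-complete k (add-invariant I Ex (disj (here refl))) ys⊆ (suc-injective len) uys Eys
           (λ y∈ys → λ { (here y≡x) → All.lookup x∉ys y∈ys (sym y≡x) ; (there y∈) → disj (there y∈ys) y∈ })
  ... | R , R∈ , AR = R , ∈-++⁺ˡ (continue-complete {k = k} {s = add rep s x} {xs = xs} (add-invariant I Ex (disj (here refl))) R∈) , AR

  candidates-complete : ∀ k → suc k ≤ ∣ E ∣ → T (E 𝟎) → ∃ λ R → R ∈ candidates rep k × All (T ∘ A) R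
  candidates-complete k k<∣E∣ E𝟎 =
    search-complete k {s = add rep (state [] emptyGrid emptyGrid) 𝟎} {xs = nonzero} {ys = someOf E k nonzero}
      (add-invariant {s = state [] emptyGrid emptyGrid} {x = 𝟎} initial E𝟎 λ ())
      (⊆-trans (someOf-⊆ E k nonzero) (filter-⊆ (T? ∘ E) nonzero))
      (someOf-length E k nonzero (≤-pred (subst (suc k ≤_) ∣E∣≡ k<∣E∣)))
      (someOf-unique E k nonzero (drop⁺ 1 points-unique))
      (someOf-⊆X E k nonzero)
      λ y∈ → λ { (here refl) → 𝟎∉nonzero (proj₁ (∈-filter⁻ (T? ∘ E) (Sublist.lookup (someOf-⊆ E k nonzero) y∈))) }
    where
    nonzero : List Pt₃
    nonzero = drop 1 points
    𝟎∉nonzero : 𝟎 ∉ nonzero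
    𝟎∉nonzero 𝟎∈ = All.lookup (AllPairs.head points-unique) 𝟎∈ refl
    ∣E∣≡ : ∣ E ∣ ≡ suc (length (filterᵇ E nonzero))
    ∣E∣≡ = trans (cong (length ∘ filterᵇ E) points≡𝟎∷nonzero) (cong length (filter-accept (T? ∘ E) {xs = nonzero} E𝟎))

covers : List Pt₃ → List Pt₃ → Bool
covers A₁ C₁ = all (λ q → any (λ a → any (λ c → a ⊞ q ⊞ c == 𝟎) C₁) A₁) points

allCover : List (List Pt₃) → Bool
allCover Rs = all (λ R₁ → all (covers R₁) distinct) distinct
  where
  distinct : List (List Pt₃)
  distinct = deduplicate (List.≡-dec _≟ᵥ_) Rs

allCover-sound : ∀ {Rs A₁ C₁} → T (allCover Rs) → A₁ ∈ Rs → C₁ ∈ Rs →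
  ∀ q → ∃₂ λ a c → a ∈ A₁ × c ∈ C₁ × a ⊞ q ⊞ c ≡ 𝟎
allCover-sound {Rs} {A₁} {C₁} h A₁∈ C₁∈ q =
  let (a , a∈ , h') = find (Any.any⁻ (λ a → any (λ c → a ⊞ q ⊞ c == 𝟎) C₁) A₁ covered-q)
      (c , c∈ , h'') = find (Any.any⁻ (λ c → a ⊞ q ⊞ c == 𝟎) C₁ h')
  in a , c , a∈ , c∈ , ==-sound h''
  where
  distinct : List (List Pt₃)
  distinct = deduplicate (List.≡-dec _≟ᵥ_) Rs
  dedup⁺ : ∀ {R} → R ∈ Rs → R ∈ distinct
  dedup⁺ = ∈-deduplicate⁺ (List.≡-dec _≟ᵥ_)
  covered : T (covers A₁ C₁)
  covered = All.lookup (All.all⁺ (covers A₁) distinct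
              (All.lookup (All.all⁺ (λ R₁ → all (covers R₁) distinct) distinct h) (dedup⁺ A₁∈))) (dedup⁺ C₁∈)
  covered-q : T (any (λ a → any (λ c → a ⊞ q ⊞ c == 𝟎) C₁) A₁)
  covered-q = All.lookup (All.all⁺ (λ q → any (λ a → any (λ c → a ⊞ q ⊞ c == 𝟎) C₁) A₁) points covered) (∈-allVecs q)

no-config-containing : ∀ rep k → suc k ≡ sE → (c : Config sO sE) → let open Config c in
  All (T ∘ O) rep → T (D 𝟎) → T (E 𝟎) → allCover (candidates rep k) ≡ true → ⊥
no-config-containing rep k refl c rep⊆O D𝟎 E𝟎 covered = contradiction-at (element B points 1≤∣B∣)
    (CandidateSearch.candidates-complete rep rep⊆O cap-E cap-A sumFree-AOE 8≤∣A∣ k sE≤∣E∣ E𝟎)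
    (CandidateSearch.candidates-complete rep rep⊆O cap-D cap-C sumFree-COD 8≤∣C∣ k sE≤∣D∣ D𝟎)
  where
  open Config c
  contradiction-at : (∃ λ b → b ∈ points × T (B b)) →
    (∃ λ R → R ∈ candidates rep k × All (T ∘ A) R) → (∃ λ R → R ∈ candidates rep k × All (T ∘ C) R) → ⊥
  contradiction-at (b , _ , Bb) (A₁ , A₁∈ , A₁⊆A) (C₁ , C₁∈ , C₁⊆C) =
    let (a , c , a∈ , c∈ , sum≡𝟎) = allCover-sound (Equivalence.from T-≡ covered) A₁∈ C₁∈ b
    in sumFree-ABC sum≡𝟎 (All.lookup A₁⊆A a∈) Bb (All.lookup C₁⊆C c∈)

-- Classifying the central cap

inFrame : Pt₃ → Bool
inFrame w = any (w ==_) frame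

outside : List Pt₃
outside = filterᵇ (not ∘ inFrame) points

frameCaps : ℕ → List (List Pt₃)
frameCaps s = capExtensions (s ∸ 4) (length outside) frame outside

frame-cap : (c : Config sO sE) → All (T ∘ Config.O c) frame → ∃ λ R → R ∈ frameCaps sO × All (T ∘ Config.O c) R
frame-cap {sO} c frame⊆O =
  capExtensions-complete cap-O (sO ∸ 4) frame {xs = outside} {ys = ys}
    (⊆-trans (someOf-⊆ O (sO ∸ 4) outside) (filter-⊆ (T? ∘ O) outside))
    (someOf-length O (sO ∸ 4) outside (m≤n+o⇒m∸n≤o sO 4 sO≤4+))
    (someOf-unique O (sO ∸ 4) outside (unique-filter⁺ (T? ∘ (not ∘ inFrame)) points-unique))
    frame-unique
    (λ {y} y∈ys y∈frame → T-not⁻ (inFrame y)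
       (outside-of (Sublist.lookup (filter-⊆ (T? ∘ O) outside) (Sublist.lookup (someOf-⊆ O (sO ∸ 4) outside) y∈ys)))
       (Any.any⁺ (y ==_) (Any.map ==-complete y∈frame)))
    (someOf-⊆X O (sO ∸ 4) outside)
    frame⊆O
  where
  open Config c
  ys : List Pt₃
  ys = someOf O (sO ∸ 4) outside
  frame-unique : Unique frame
  frame-unique = from-yes (unique? _≟ᵥ_ frame)
  outside-of : ∀ {y} → y ∈ outside → T (not (inFrame y))
  outside-of y∈ = proj₂ (∈-filter⁻ (T? ∘ (not ∘ inFrame)) {xs = points} y∈)
  sO≤4+ : sO ≤ 4 + length (filterᵇ O outside)
  sO≤4+ = begin
    sO                                                                      ≤⟨ sO≤∣O∣ ⟩
    ∣ O ∣                                                                   ≡⟨ length-filter-split O inFrame points ⟩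
    length (filterᵇ O (filterᵇ inFrame points)) + length (filterᵇ O outside) ≤⟨ +-monoˡ-≤ _ (length-filter (T? ∘ O) (filterᵇ inFrame points)) ⟩
    length (filterᵇ inFrame points) + length (filterᵇ O outside)            ≡⟨⟩
    4 + length (filterᵇ O outside)                                          ∎
    where open ≤-Reasoning

record Entry (n : ℕ) : Set where
  constructor entry
  field
    rep : Fin n
    M : Matrix
    t : Pt₃

embeds : List Pt₃ → Matrix → Pt₃ → List Pt₃ → Bool
embeds rep M t R = ⌊ nonsingular? M ⌋ ∧ all (λ p → any (affine M t p ==_) R) rep

classifies : ∀ {n} → (Fin n → List Pt₃) → List (List Pt₃) → List (Entry n) → Bool
classifies reps [] [] = true
classifies reps (R ∷ Rs) (entry r M t ∷ es) = embeds (reps r) M t R ∧ classifies reps Rs es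
classifies reps [] (_ ∷ _) = false
classifies reps (_ ∷ _) [] = false

classifies-sound : ∀ {n} (reps : Fin n → List Pt₃) {Rs es R} → T (classifies reps Rs es) → R ∈ Rs →
  ∃ λ e → T (embeds (reps (Entry.rep e)) (Entry.M e) (Entry.t e) R)
classifies-sound reps {R ∷ Rs} {entry r M t ∷ es} h (here refl) = entry r M t , proj₁ (T-∧⁻ (embeds (reps r) M t R) h)
classifies-sound reps {R ∷ Rs} {entry r M t ∷ es} h (there R∈) = classifies-sound reps (proj₂ (T-∧⁻ (embeds (reps r) M t R) h)) R∈

embeds-sound : ∀ {rep M t R} → T (embeds rep M t R) →
  Nonsingular M × (∀ {X : Pt₃ → Bool} → All (T ∘ X) R → All (T ∘ X ∘ affine M t) rep)
embeds-sound {rep} {M} {t} {R} h =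
  toWitness (proj₁ (T-∧⁻ ⌊ nonsingular? M ⌋ h)) ,
  λ {X} R⊆X → All.map (λ {p} p↦R → let (q , q∈R , p↦q) = find (Any.any⁻ (affine M t p ==_) R p↦R)
                                    in subst (T ∘ X) (sym (==-sound p↦q)) (All.lookup R⊆X q∈R))
                      (All.all⁺ _ rep (proj₂ (T-∧⁻ ⌊ nonsingular? M ⌋ h)))

module _ {n} (reps : Fin n → List Pt₃) (table : List (Entry n)) {k} (k+1≡sE : suc k ≡ sE)
         (classified : classifies reps (frameCaps sO) table ≡ true)
         (covered : ∀ r → allCover (candidates (reps r) k) ≡ true) where

  no-normalised-config : (c : Config sO sE) → Normalised c → ⊥
  no-normalised-config c (frame⊆O , D𝟎 , E𝟎) = through-cap (frame-cap c frame⊆O)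
    where
    open Config c
    through-entry : ∀ {R} → All (T ∘ O) R → (∃ λ e → T (embeds (reps (Entry.rep e)) (Entry.M e) (Entry.t e) R)) → ⊥
    through-entry R⊆O (entry r M t , embedded) =
      let (M-ns , transport) = embeds-sound embedded
      in no-config-containing (reps r) k k+1≡sE (pullback c M M-ns t 𝟎 𝟎) (transport R⊆O)
           (∈-pullback {X = D} M 𝟎 𝟎 (∙𝟎⊞ M 𝟎) D𝟎) (∈-pullback {X = E} M 𝟎 𝟎 (∙𝟎⊞ M 𝟎) E𝟎) (covered r)
    through-cap : (∃ λ R → R ∈ frameCaps sO × All (T ∘ O) R) → ⊥
    through-cap (R , R∈ , R⊆O) = through-entry R⊆O (classifies-sound reps (Equivalence.from T-≡ classified) R∈)

  no-config : 5 ≤ sO → ¬ Config sO sE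
  no-config 5≤sO c = uncurry no-normalised-config (normalise c 5≤sO (subst (1 ≤_) k+1≡sE (s≤s z≤n)))

⟨_,_,_⟩ : ℕ → ℕ → ℕ → Pt₃
⟨ a , b , c ⟩ = a mod 3 ∷ b mod 3 ∷ c mod 3 ∷ []

sixCapReps : Fin 3 → List Pt₃
sixCapReps zero = ⟨ 0 , 0 , 0 ⟩ ∷ ⟨ 0 , 0 , 1 ⟩ ∷ ⟨ 0 , 1 , 0 ⟩ ∷ ⟨ 0 , 1 , 1 ⟩ ∷ ⟨ 1 , 0 , 0 ⟩ ∷ ⟨ 1 , 0 , 1 ⟩ ∷ []
sixCapReps (suc zero) = ⟨ 0 , 0 , 0 ⟩ ∷ ⟨ 0 , 0 , 1 ⟩ ∷ ⟨ 0 , 1 , 0 ⟩ ∷ ⟨ 0 , 1 , 1 ⟩ ∷ ⟨ 1 , 0 , 0 ⟩ ∷ ⟨ 1 , 1 , 1 ⟩ ∷ []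
sixCapReps (suc (suc zero)) = ⟨ 0 , 0 , 0 ⟩ ∷ ⟨ 0 , 0 , 1 ⟩ ∷ ⟨ 0 , 1 , 0 ⟩ ∷ ⟨ 0 , 1 , 1 ⟩ ∷ ⟨ 1 , 0 , 0 ⟩ ∷ ⟨ 2 , 1 , 1 ⟩ ∷ []

fiveCapReps : Fin 2 → List Pt₃
fiveCapReps zero = ⟨ 0 , 0 , 0 ⟩ ∷ ⟨ 0 , 0 , 1 ⟩ ∷ ⟨ 0 , 1 , 0 ⟩ ∷ ⟨ 0 , 1 , 1 ⟩ ∷ ⟨ 1 , 0 , 0 ⟩ ∷ []
fiveCapReps (suc zero) = ⟨ 0 , 0 , 0 ⟩ ∷ ⟨ 0 , 0 , 1 ⟩ ∷ ⟨ 0 , 1 , 0 ⟩ ∷ ⟨ 1 , 0 , 0 ⟩ ∷ ⟨ 1 , 1 , 1 ⟩ ∷ []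

sixCapTable : List (Entry 3)
sixCapTable =
  entry (# 0) (matrix ⟨ 0 , 1 , 2 ⟩ ⟨ 0 , 0 , 2 ⟩ ⟨ 2 , 0 , 0 ⟩) ⟨ 1 , 0 , 1 ⟩ ∷
  entry (# 0) (matrix ⟨ 1 , 1 , 2 ⟩ ⟨ 1 , 0 , 2 ⟩ ⟨ 1 , 0 , 0 ⟩) ⟨ 2 , 0 , 1 ⟩ ∷
  entry (# 0) (matrix ⟨ 1 , 0 , 2 ⟩ ⟨ 0 , 0 , 2 ⟩ ⟨ 0 , 2 , 0 ⟩) ⟨ 0 , 1 , 1 ⟩ ∷
  entry (# 1) (matrix ⟨ 0 , 0 , 1 ⟩ ⟨ 2 , 0 , 0 ⟩ ⟨ 0 , 2 , 0 ⟩) ⟨ 1 , 1 , 0 ⟩ ∷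
  entry (# 1) (matrix ⟨ 2 , 0 , 1 ⟩ ⟨ 1 , 0 , 0 ⟩ ⟨ 0 , 2 , 0 ⟩) ⟨ 0 , 1 , 0 ⟩ ∷
  entry (# 0) (matrix ⟨ 1 , 1 , 2 ⟩ ⟨ 0 , 1 , 2 ⟩ ⟨ 0 , 1 , 0 ⟩) ⟨ 0 , 2 , 1 ⟩ ∷
  entry (# 1) (matrix ⟨ 0 , 2 , 1 ⟩ ⟨ 1 , 0 , 0 ⟩ ⟨ 0 , 2 , 0 ⟩) ⟨ 0 , 1 , 0 ⟩ ∷
  entry (# 1) (matrix ⟨ 2 , 2 , 1 ⟩ ⟨ 2 , 0 , 0 ⟩ ⟨ 0 , 2 , 0 ⟩) ⟨ 1 , 1 , 0 ⟩ ∷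
  entry (# 1) (matrix ⟨ 0 , 1 , 0 ⟩ ⟨ 0 , 0 , 2 ⟩ ⟨ 2 , 0 , 1 ⟩) ⟨ 1 , 0 , 0 ⟩ ∷
  entry (# 1) (matrix ⟨ 1 , 0 , 0 ⟩ ⟨ 0 , 0 , 2 ⟩ ⟨ 0 , 2 , 1 ⟩) ⟨ 0 , 1 , 0 ⟩ ∷
  entry (# 2) (matrix ⟨ 0 , 0 , 1 ⟩ ⟨ 2 , 0 , 1 ⟩ ⟨ 0 , 2 , 1 ⟩) ⟨ 1 , 1 , 2 ⟩ ∷
  entry (# 1) (matrix ⟨ 2 , 0 , 0 ⟩ ⟨ 1 , 0 , 2 ⟩ ⟨ 2 , 2 , 1 ⟩) ⟨ 1 , 1 , 0 ⟩ ∷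
  entry (# 1) (matrix ⟨ 0 , 2 , 0 ⟩ ⟨ 0 , 1 , 2 ⟩ ⟨ 2 , 2 , 1 ⟩) ⟨ 1 , 1 , 0 ⟩ ∷
  entry (# 0) (matrix ⟨ 2 , 1 , 2 ⟩ ⟨ 0 , 0 , 2 ⟩ ⟨ 2 , 0 , 0 ⟩) ⟨ 1 , 0 , 1 ⟩ ∷
  entry (# 0) (matrix ⟨ 0 , 1 , 2 ⟩ ⟨ 1 , 0 , 2 ⟩ ⟨ 1 , 0 , 0 ⟩) ⟨ 2 , 0 , 1 ⟩ ∷
  entry (# 1) (matrix ⟨ 0 , 0 , 1 ⟩ ⟨ 2 , 0 , 0 ⟩ ⟨ 1 , 2 , 0 ⟩) ⟨ 0 , 1 , 0 ⟩ ∷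
  entry (# 1) (matrix ⟨ 2 , 0 , 1 ⟩ ⟨ 1 , 0 , 0 ⟩ ⟨ 1 , 2 , 0 ⟩) ⟨ 2 , 1 , 0 ⟩ ∷
  entry (# 0) (matrix ⟨ 0 , 0 , 2 ⟩ ⟨ 1 , 0 , 2 ⟩ ⟨ 1 , 2 , 0 ⟩) ⟨ 2 , 1 , 1 ⟩ ∷
  entry (# 1) (matrix ⟨ 0 , 2 , 1 ⟩ ⟨ 2 , 0 , 0 ⟩ ⟨ 1 , 2 , 0 ⟩) ⟨ 0 , 1 , 0 ⟩ ∷
  entry (# 0) (matrix ⟨ 0 , 1 , 2 ⟩ ⟨ 2 , 1 , 2 ⟩ ⟨ 2 , 1 , 0 ⟩) ⟨ 1 , 2 , 1 ⟩ ∷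
  entry (# 1) (matrix ⟨ 1 , 2 , 1 ⟩ ⟨ 1 , 0 , 0 ⟩ ⟨ 1 , 2 , 0 ⟩) ⟨ 2 , 1 , 0 ⟩ ∷
  entry (# 1) (matrix ⟨ 2 , 1 , 0 ⟩ ⟨ 0 , 0 , 2 ⟩ ⟨ 2 , 0 , 1 ⟩) ⟨ 1 , 0 , 0 ⟩ ∷
  entry (# 2) (matrix ⟨ 2 , 0 , 1 ⟩ ⟨ 0 , 0 , 1 ⟩ ⟨ 0 , 2 , 1 ⟩) ⟨ 0 , 1 , 2 ⟩ ∷
  entry (# 1) (matrix ⟨ 2 , 0 , 0 ⟩ ⟨ 1 , 0 , 2 ⟩ ⟨ 0 , 2 , 1 ⟩) ⟨ 0 , 1 , 0 ⟩ ∷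
  entry (# 1) (matrix ⟨ 1 , 0 , 0 ⟩ ⟨ 0 , 0 , 2 ⟩ ⟨ 1 , 2 , 1 ⟩) ⟨ 2 , 1 , 0 ⟩ ∷
  entry (# 1) (matrix ⟨ 1 , 2 , 0 ⟩ ⟨ 0 , 1 , 2 ⟩ ⟨ 1 , 2 , 1 ⟩) ⟨ 2 , 1 , 0 ⟩ ∷
  entry (# 1) (matrix ⟨ 0 , 0 , 1 ⟩ ⟨ 0 , 2 , 0 ⟩ ⟨ 2 , 1 , 0 ⟩) ⟨ 1 , 0 , 0 ⟩ ∷
  entry (# 1) (matrix ⟨ 2 , 0 , 1 ⟩ ⟨ 0 , 2 , 0 ⟩ ⟨ 2 , 1 , 0 ⟩) ⟨ 1 , 0 , 0 ⟩ ∷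
  entry (# 0) (matrix ⟨ 0 , 0 , 2 ⟩ ⟨ 1 , 2 , 2 ⟩ ⟨ 0 , 2 , 0 ⟩) ⟨ 0 , 1 , 1 ⟩ ∷
  entry (# 1) (matrix ⟨ 0 , 2 , 1 ⟩ ⟨ 0 , 1 , 0 ⟩ ⟨ 2 , 1 , 0 ⟩) ⟨ 1 , 2 , 0 ⟩ ∷
  entry (# 0) (matrix ⟨ 1 , 0 , 2 ⟩ ⟨ 1 , 2 , 2 ⟩ ⟨ 1 , 2 , 0 ⟩) ⟨ 2 , 1 , 1 ⟩ ∷
  entry (# 0) (matrix ⟨ 1 , 0 , 2 ⟩ ⟨ 0 , 1 , 2 ⟩ ⟨ 0 , 1 , 0 ⟩) ⟨ 0 , 2 , 1 ⟩ ∷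
  entry (# 0) (matrix ⟨ 0 , 0 , 2 ⟩ ⟨ 0 , 1 , 2 ⟩ ⟨ 2 , 1 , 0 ⟩) ⟨ 1 , 2 , 1 ⟩ ∷
  entry (# 1) (matrix ⟨ 2 , 1 , 1 ⟩ ⟨ 0 , 1 , 0 ⟩ ⟨ 2 , 1 , 0 ⟩) ⟨ 1 , 2 , 0 ⟩ ∷
  entry (# 2) (matrix ⟨ 0 , 2 , 1 ⟩ ⟨ 0 , 0 , 1 ⟩ ⟨ 2 , 0 , 1 ⟩) ⟨ 1 , 0 , 2 ⟩ ∷
  entry (# 1) (matrix ⟨ 1 , 2 , 0 ⟩ ⟨ 0 , 0 , 2 ⟩ ⟨ 0 , 2 , 1 ⟩) ⟨ 0 , 1 , 0 ⟩ ∷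
  entry (# 1) (matrix ⟨ 0 , 2 , 0 ⟩ ⟨ 1 , 0 , 2 ⟩ ⟨ 0 , 2 , 1 ⟩) ⟨ 0 , 1 , 0 ⟩ ∷
  entry (# 1) (matrix ⟨ 0 , 1 , 0 ⟩ ⟨ 0 , 0 , 2 ⟩ ⟨ 2 , 1 , 1 ⟩) ⟨ 1 , 2 , 0 ⟩ ∷
  entry (# 1) (matrix ⟨ 2 , 1 , 0 ⟩ ⟨ 1 , 0 , 2 ⟩ ⟨ 2 , 1 , 1 ⟩) ⟨ 1 , 2 , 0 ⟩ ∷
  entry (# 0) (matrix ⟨ 1 , 2 , 0 ⟩ ⟨ 0 , 2 , 0 ⟩ ⟨ 0 , 0 , 2 ⟩) ⟨ 0 , 1 , 1 ⟩ ∷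
  entry (# 1) (matrix ⟨ 0 , 1 , 0 ⟩ ⟨ 2 , 0 , 0 ⟩ ⟨ 0 , 0 , 2 ⟩) ⟨ 1 , 0 , 1 ⟩ ∷
  entry (# 1) (matrix ⟨ 2 , 1 , 0 ⟩ ⟨ 1 , 0 , 0 ⟩ ⟨ 0 , 0 , 2 ⟩) ⟨ 0 , 0 , 1 ⟩ ∷
  entry (# 1) (matrix ⟨ 1 , 0 , 0 ⟩ ⟨ 0 , 2 , 0 ⟩ ⟨ 0 , 1 , 2 ⟩) ⟨ 0 , 0 , 1 ⟩ ∷
  entry (# 2) (matrix ⟨ 0 , 1 , 0 ⟩ ⟨ 2 , 1 , 0 ⟩ ⟨ 0 , 1 , 2 ⟩) ⟨ 1 , 2 , 1 ⟩ ∷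
  entry (# 1) (matrix ⟨ 2 , 0 , 0 ⟩ ⟨ 1 , 2 , 0 ⟩ ⟨ 2 , 1 , 2 ⟩) ⟨ 1 , 0 , 1 ⟩ ∷
  entry (# 0) (matrix ⟨ 1 , 2 , 1 ⟩ ⟨ 0 , 2 , 1 ⟩ ⟨ 0 , 0 , 1 ⟩) ⟨ 0 , 1 , 2 ⟩ ∷
  entry (# 1) (matrix ⟨ 0 , 1 , 2 ⟩ ⟨ 1 , 0 , 0 ⟩ ⟨ 0 , 0 , 2 ⟩) ⟨ 0 , 0 , 1 ⟩ ∷
  entry (# 1) (matrix ⟨ 2 , 1 , 2 ⟩ ⟨ 2 , 0 , 0 ⟩ ⟨ 0 , 0 , 2 ⟩) ⟨ 1 , 0 , 1 ⟩ ∷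
  entry (# 1) (matrix ⟨ 0 , 0 , 2 ⟩ ⟨ 0 , 2 , 1 ⟩ ⟨ 2 , 1 , 2 ⟩) ⟨ 1 , 0 , 1 ⟩ ∷
  entry (# 1) (matrix ⟨ 0 , 1 , 0 ⟩ ⟨ 2 , 0 , 0 ⟩ ⟨ 1 , 0 , 2 ⟩) ⟨ 0 , 0 , 1 ⟩ ∷
  entry (# 1) (matrix ⟨ 2 , 1 , 0 ⟩ ⟨ 1 , 0 , 0 ⟩ ⟨ 1 , 0 , 2 ⟩) ⟨ 2 , 0 , 1 ⟩ ∷
  entry (# 0) (matrix ⟨ 0 , 2 , 0 ⟩ ⟨ 1 , 2 , 0 ⟩ ⟨ 1 , 0 , 2 ⟩) ⟨ 2 , 1 , 1 ⟩ ∷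
  entry (# 2) (matrix ⟨ 2 , 1 , 0 ⟩ ⟨ 0 , 1 , 0 ⟩ ⟨ 0 , 1 , 2 ⟩) ⟨ 0 , 2 , 1 ⟩ ∷
  entry (# 1) (matrix ⟨ 2 , 0 , 0 ⟩ ⟨ 1 , 2 , 0 ⟩ ⟨ 0 , 1 , 2 ⟩) ⟨ 0 , 0 , 1 ⟩ ∷
  entry (# 1) (matrix ⟨ 1 , 0 , 0 ⟩ ⟨ 0 , 2 , 0 ⟩ ⟨ 1 , 1 , 2 ⟩) ⟨ 2 , 0 , 1 ⟩ ∷
  entry (# 1) (matrix ⟨ 0 , 1 , 2 ⟩ ⟨ 2 , 0 , 0 ⟩ ⟨ 1 , 0 , 2 ⟩) ⟨ 0 , 0 , 1 ⟩ ∷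
  entry (# 0) (matrix ⟨ 0 , 2 , 1 ⟩ ⟨ 2 , 2 , 1 ⟩ ⟨ 2 , 0 , 1 ⟩) ⟨ 1 , 1 , 2 ⟩ ∷
  entry (# 1) (matrix ⟨ 1 , 1 , 2 ⟩ ⟨ 1 , 0 , 0 ⟩ ⟨ 1 , 0 , 2 ⟩) ⟨ 2 , 0 , 1 ⟩ ∷
  entry (# 1) (matrix ⟨ 1 , 0 , 2 ⟩ ⟨ 0 , 2 , 1 ⟩ ⟨ 1 , 1 , 2 ⟩) ⟨ 2 , 0 , 1 ⟩ ∷
  entry (# 1) (matrix ⟨ 1 , 0 , 0 ⟩ ⟨ 0 , 2 , 0 ⟩ ⟨ 0 , 0 , 2 ⟩) ⟨ 0 , 1 , 1 ⟩ ∷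
  entry (# 2) (matrix ⟨ 1 , 0 , 0 ⟩ ⟨ 1 , 2 , 0 ⟩ ⟨ 1 , 0 , 2 ⟩) ⟨ 2 , 1 , 1 ⟩ ∷
  entry (# 1) (matrix ⟨ 1 , 2 , 0 ⟩ ⟨ 0 , 1 , 0 ⟩ ⟨ 0 , 0 , 2 ⟩) ⟨ 0 , 0 , 1 ⟩ ∷
  entry (# 1) (matrix ⟨ 0 , 2 , 0 ⟩ ⟨ 2 , 1 , 0 ⟩ ⟨ 1 , 2 , 2 ⟩) ⟨ 0 , 1 , 1 ⟩ ∷
  entry (# 0) (matrix ⟨ 2 , 1 , 1 ⟩ ⟨ 2 , 0 , 1 ⟩ ⟨ 0 , 0 , 1 ⟩) ⟨ 1 , 0 , 2 ⟩ ∷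
  entry (# 1) (matrix ⟨ 1 , 0 , 2 ⟩ ⟨ 0 , 1 , 0 ⟩ ⟨ 0 , 0 , 2 ⟩) ⟨ 0 , 0 , 1 ⟩ ∷
  entry (# 1) (matrix ⟨ 0 , 0 , 2 ⟩ ⟨ 2 , 0 , 1 ⟩ ⟨ 1 , 2 , 2 ⟩) ⟨ 0 , 1 , 1 ⟩ ∷
  entry (# 1) (matrix ⟨ 1 , 2 , 2 ⟩ ⟨ 0 , 2 , 0 ⟩ ⟨ 0 , 0 , 2 ⟩) ⟨ 0 , 1 , 1 ⟩ ∷
  entry (# 1) (matrix ⟨ 2 , 0 , 0 ⟩ ⟨ 1 , 2 , 0 ⟩ ⟨ 1 , 0 , 2 ⟩) ⟨ 2 , 1 , 1 ⟩ ∷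
  entry (# 1) (matrix ⟨ 1 , 2 , 0 ⟩ ⟨ 0 , 1 , 0 ⟩ ⟨ 0 , 1 , 2 ⟩) ⟨ 0 , 2 , 1 ⟩ ∷
  entry (# 1) (matrix ⟨ 0 , 2 , 0 ⟩ ⟨ 2 , 1 , 0 ⟩ ⟨ 0 , 1 , 2 ⟩) ⟨ 1 , 2 , 1 ⟩ ∷
  entry (# 1) (matrix ⟨ 0 , 1 , 2 ⟩ ⟨ 0 , 0 , 1 ⟩ ⟨ 2 , 0 , 1 ⟩) ⟨ 1 , 0 , 2 ⟩ ∷
  entry (# 1) (matrix ⟨ 1 , 0 , 2 ⟩ ⟨ 0 , 0 , 1 ⟩ ⟨ 0 , 2 , 1 ⟩) ⟨ 0 , 1 , 2 ⟩ ∷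
  entry (# 1) (matrix ⟨ 0 , 0 , 2 ⟩ ⟨ 2 , 0 , 1 ⟩ ⟨ 0 , 2 , 1 ⟩) ⟨ 1 , 1 , 2 ⟩ ∷
  entry (# 1) (matrix ⟨ 0 , 2 , 0 ⟩ ⟨ 2 , 1 , 0 ⟩ ⟨ 1 , 0 , 2 ⟩) ⟨ 0 , 0 , 1 ⟩ ∷
  entry (# 1) (matrix ⟨ 1 , 2 , 0 ⟩ ⟨ 0 , 1 , 0 ⟩ ⟨ 1 , 2 , 2 ⟩) ⟨ 2 , 1 , 1 ⟩ ∷
  entry (# 0) (matrix ⟨ 2 , 1 , 1 ⟩ ⟨ 0 , 0 , 1 ⟩ ⟨ 2 , 0 , 1 ⟩) ⟨ 1 , 0 , 2 ⟩ ∷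
  entry (# 1) (matrix ⟨ 0 , 0 , 2 ⟩ ⟨ 2 , 1 , 0 ⟩ ⟨ 1 , 0 , 2 ⟩) ⟨ 0 , 0 , 1 ⟩ ∷
  entry (# 1) (matrix ⟨ 1 , 0 , 2 ⟩ ⟨ 0 , 0 , 1 ⟩ ⟨ 1 , 2 , 2 ⟩) ⟨ 2 , 1 , 1 ⟩ ∷
  entry (# 1) (matrix ⟨ 1 , 2 , 2 ⟩ ⟨ 1 , 2 , 0 ⟩ ⟨ 1 , 0 , 2 ⟩) ⟨ 2 , 1 , 1 ⟩ ∷
  entry (# 0) (matrix ⟨ 2 , 0 , 0 ⟩ ⟨ 2 , 1 , 0 ⟩ ⟨ 0 , 1 , 2 ⟩) ⟨ 1 , 2 , 1 ⟩ ∷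
  entry (# 1) (matrix ⟨ 0 , 1 , 0 ⟩ ⟨ 2 , 0 , 0 ⟩ ⟨ 1 , 1 , 2 ⟩) ⟨ 0 , 2 , 1 ⟩ ∷
  entry (# 1) (matrix ⟨ 1 , 0 , 2 ⟩ ⟨ 0 , 2 , 0 ⟩ ⟨ 0 , 1 , 2 ⟩) ⟨ 0 , 0 , 1 ⟩ ∷
  entry (# 0) (matrix ⟨ 2 , 0 , 1 ⟩ ⟨ 2 , 2 , 1 ⟩ ⟨ 0 , 2 , 1 ⟩) ⟨ 1 , 1 , 2 ⟩ ∷
  entry (# 1) (matrix ⟨ 1 , 1 , 2 ⟩ ⟨ 0 , 1 , 0 ⟩ ⟨ 0 , 1 , 2 ⟩) ⟨ 0 , 2 , 1 ⟩ ∷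
  entry (# 1) (matrix ⟨ 0 , 1 , 2 ⟩ ⟨ 2 , 0 , 1 ⟩ ⟨ 1 , 1 , 2 ⟩) ⟨ 0 , 2 , 1 ⟩ ∷
  entry (# 1) (matrix ⟨ 2 , 1 , 0 ⟩ ⟨ 1 , 0 , 0 ⟩ ⟨ 2 , 1 , 2 ⟩) ⟨ 1 , 2 , 1 ⟩ ∷
  entry (# 1) (matrix ⟨ 0 , 0 , 2 ⟩ ⟨ 1 , 2 , 0 ⟩ ⟨ 0 , 1 , 2 ⟩) ⟨ 0 , 0 , 1 ⟩ ∷
  entry (# 0) (matrix ⟨ 0 , 0 , 1 ⟩ ⟨ 1 , 2 , 1 ⟩ ⟨ 0 , 2 , 1 ⟩) ⟨ 0 , 1 , 2 ⟩ ∷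
  entry (# 1) (matrix ⟨ 0 , 1 , 2 ⟩ ⟨ 0 , 0 , 1 ⟩ ⟨ 2 , 1 , 2 ⟩) ⟨ 1 , 2 , 1 ⟩ ∷
  entry (# 1) (matrix ⟨ 2 , 1 , 2 ⟩ ⟨ 2 , 1 , 0 ⟩ ⟨ 0 , 1 , 2 ⟩) ⟨ 1 , 2 , 1 ⟩ ∷
  entry (# 1) (matrix ⟨ 1 , 2 , 2 ⟩ ⟨ 2 , 2 , 1 ⟩ ⟨ 1 , 2 , 1 ⟩) ⟨ 2 , 1 , 2 ⟩ ∷
  entry (# 1) (matrix ⟨ 2 , 1 , 2 ⟩ ⟨ 2 , 2 , 1 ⟩ ⟨ 2 , 1 , 1 ⟩) ⟨ 1 , 2 , 2 ⟩ ∷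
  entry (# 1) (matrix ⟨ 1 , 1 , 2 ⟩ ⟨ 1 , 2 , 1 ⟩ ⟨ 2 , 1 , 1 ⟩) ⟨ 2 , 2 , 2 ⟩ ∷
  entry (# 0) (matrix ⟨ 1 , 2 , 0 ⟩ ⟨ 0 , 2 , 1 ⟩ ⟨ 0 , 0 , 1 ⟩) ⟨ 0 , 1 , 2 ⟩ ∷
  entry (# 0) (matrix ⟨ 0 , 2 , 0 ⟩ ⟨ 0 , 2 , 1 ⟩ ⟨ 2 , 0 , 1 ⟩) ⟨ 1 , 1 , 2 ⟩ ∷
  entry (# 1) (matrix ⟨ 2 , 1 , 1 ⟩ ⟨ 0 , 0 , 1 ⟩ ⟨ 2 , 0 , 1 ⟩) ⟨ 1 , 0 , 2 ⟩ ∷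
  entry (# 1) (matrix ⟨ 0 , 0 , 1 ⟩ ⟨ 0 , 2 , 0 ⟩ ⟨ 2 , 1 , 1 ⟩) ⟨ 1 , 0 , 2 ⟩ ∷
  entry (# 1) (matrix ⟨ 2 , 0 , 1 ⟩ ⟨ 1 , 2 , 0 ⟩ ⟨ 2 , 1 , 1 ⟩) ⟨ 1 , 0 , 2 ⟩ ∷
  entry (# 0) (matrix ⟨ 2 , 0 , 0 ⟩ ⟨ 2 , 0 , 1 ⟩ ⟨ 0 , 2 , 1 ⟩) ⟨ 1 , 1 , 2 ⟩ ∷
  entry (# 1) (matrix ⟨ 0 , 0 , 1 ⟩ ⟨ 2 , 0 , 0 ⟩ ⟨ 1 , 2 , 1 ⟩) ⟨ 0 , 1 , 2 ⟩ ∷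
  entry (# 1) (matrix ⟨ 1 , 2 , 1 ⟩ ⟨ 0 , 0 , 1 ⟩ ⟨ 0 , 2 , 1 ⟩) ⟨ 0 , 1 , 2 ⟩ ∷
  entry (# 1) (matrix ⟨ 0 , 2 , 1 ⟩ ⟨ 2 , 1 , 0 ⟩ ⟨ 1 , 2 , 1 ⟩) ⟨ 0 , 1 , 2 ⟩ ∷
  entry (# 1) (matrix ⟨ 2 , 0 , 1 ⟩ ⟨ 1 , 0 , 0 ⟩ ⟨ 2 , 2 , 1 ⟩) ⟨ 1 , 1 , 2 ⟩ ∷
  entry (# 1) (matrix ⟨ 0 , 2 , 1 ⟩ ⟨ 0 , 1 , 0 ⟩ ⟨ 2 , 2 , 1 ⟩) ⟨ 1 , 1 , 2 ⟩ ∷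
  entry (# 1) (matrix ⟨ 2 , 2 , 1 ⟩ ⟨ 2 , 0 , 1 ⟩ ⟨ 0 , 2 , 1 ⟩) ⟨ 1 , 1 , 2 ⟩ ∷
  entry (# 1) (matrix ⟨ 2 , 2 , 1 ⟩ ⟨ 2 , 1 , 2 ⟩ ⟨ 2 , 1 , 1 ⟩) ⟨ 1 , 2 , 2 ⟩ ∷
  entry (# 1) (matrix ⟨ 1 , 2 , 1 ⟩ ⟨ 1 , 1 , 2 ⟩ ⟨ 2 , 1 , 1 ⟩) ⟨ 2 , 2 , 2 ⟩ ∷
  entry (# 1) (matrix ⟨ 2 , 1 , 1 ⟩ ⟨ 1 , 1 , 2 ⟩ ⟨ 1 , 2 , 1 ⟩) ⟨ 2 , 2 , 2 ⟩ ∷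
  []

fiveCapTable : List (Entry 2)
fiveCapTable =
  entry (# 0) (matrix ⟨ 2 , 2 , 1 ⟩ ⟨ 2 , 0 , 0 ⟩ ⟨ 0 , 2 , 0 ⟩) ⟨ 1 , 1 , 0 ⟩ ∷
  entry (# 0) (matrix ⟨ 1 , 2 , 1 ⟩ ⟨ 1 , 0 , 0 ⟩ ⟨ 1 , 2 , 0 ⟩) ⟨ 2 , 1 , 0 ⟩ ∷
  entry (# 0) (matrix ⟨ 2 , 1 , 1 ⟩ ⟨ 0 , 1 , 0 ⟩ ⟨ 2 , 1 , 0 ⟩) ⟨ 1 , 2 , 0 ⟩ ∷
  entry (# 0) (matrix ⟨ 2 , 1 , 2 ⟩ ⟨ 2 , 0 , 0 ⟩ ⟨ 0 , 0 , 2 ⟩) ⟨ 1 , 0 , 1 ⟩ ∷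
  entry (# 0) (matrix ⟨ 1 , 1 , 2 ⟩ ⟨ 1 , 0 , 0 ⟩ ⟨ 1 , 0 , 2 ⟩) ⟨ 2 , 0 , 1 ⟩ ∷
  entry (# 0) (matrix ⟨ 1 , 2 , 2 ⟩ ⟨ 0 , 2 , 0 ⟩ ⟨ 0 , 0 , 2 ⟩) ⟨ 0 , 1 , 1 ⟩ ∷
  entry (# 1) (matrix ⟨ 0 , 1 , 2 ⟩ ⟨ 1 , 0 , 2 ⟩ ⟨ 0 , 0 , 2 ⟩) ⟨ 0 , 0 , 1 ⟩ ∷
  entry (# 0) (matrix ⟨ 1 , 2 , 2 ⟩ ⟨ 1 , 2 , 0 ⟩ ⟨ 1 , 0 , 2 ⟩) ⟨ 2 , 1 , 1 ⟩ ∷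
  entry (# 0) (matrix ⟨ 1 , 1 , 2 ⟩ ⟨ 0 , 1 , 0 ⟩ ⟨ 0 , 1 , 2 ⟩) ⟨ 0 , 2 , 1 ⟩ ∷
  entry (# 0) (matrix ⟨ 2 , 1 , 2 ⟩ ⟨ 2 , 1 , 0 ⟩ ⟨ 0 , 1 , 2 ⟩) ⟨ 1 , 2 , 1 ⟩ ∷
  entry (# 1) (matrix ⟨ 1 , 2 , 2 ⟩ ⟨ 2 , 1 , 2 ⟩ ⟨ 1 , 1 , 2 ⟩) ⟨ 2 , 2 , 1 ⟩ ∷
  entry (# 0) (matrix ⟨ 2 , 1 , 1 ⟩ ⟨ 0 , 0 , 1 ⟩ ⟨ 2 , 0 , 1 ⟩) ⟨ 1 , 0 , 2 ⟩ ∷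
  entry (# 0) (matrix ⟨ 1 , 2 , 1 ⟩ ⟨ 0 , 0 , 1 ⟩ ⟨ 0 , 2 , 1 ⟩) ⟨ 0 , 1 , 2 ⟩ ∷
  entry (# 0) (matrix ⟨ 2 , 2 , 1 ⟩ ⟨ 2 , 0 , 1 ⟩ ⟨ 0 , 2 , 1 ⟩) ⟨ 1 , 1 , 2 ⟩ ∷
  entry (# 1) (matrix ⟨ 1 , 2 , 2 ⟩ ⟨ 2 , 2 , 1 ⟩ ⟨ 1 , 2 , 1 ⟩) ⟨ 2 , 1 , 2 ⟩ ∷
  entry (# 1) (matrix ⟨ 2 , 1 , 2 ⟩ ⟨ 2 , 2 , 1 ⟩ ⟨ 2 , 1 , 1 ⟩) ⟨ 1 , 2 , 2 ⟩ ∷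
  entry (# 1) (matrix ⟨ 1 , 1 , 2 ⟩ ⟨ 1 , 2 , 1 ⟩ ⟨ 2 , 1 , 1 ⟩) ⟨ 2 , 2 , 2 ⟩ ∷
  []

sixCapReps-covered : ∀ r → allCover (candidates (sixCapReps r) 4) ≡ true
sixCapReps-covered zero = refl
sixCapReps-covered (suc zero) = refl
sixCapReps-covered (suc (suc zero)) = refl

fiveCapReps-covered : ∀ r → allCover (candidates (fiveCapReps r) 5) ≡ true
fiveCapReps-covered zero = refl
fiveCapReps-covered (suc zero) = refl

no-config-6-5 : ¬ Config 6 5
no-config-6-5 = no-config sixCapReps sixCapTable refl refl sixCapReps-covered (s≤s (s≤s (s≤s (s≤s (s≤s z≤n)))))

no-config-5-6 : ¬ Config 5 6
no-config-5-6 = no-config fiveCapReps fiveCapTable refl refl fiveCapReps-covered (s≤s (s≤s (s≤s (s≤s (s≤s z≤n)))))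

mainTheorem3 :
    (S : Pt → Bool) → IsCap S →
    (x₁ x₂ : Coord) → Independent x₁ x₂ →
    ¬ ((count S x₁ x₂ zm1 z1 ≡ 8) × (count S x₁ x₂ z1 z1 ≡ 5) ×
       (count S x₁ x₂ zm1 z0 ≡ 1) × (count S x₁ x₂ z0 z0 ≡ 6) ×
       (count S x₁ x₂ zm1 zm1 ≡ 8) × (count S x₁ x₂ z1 zm1 ≡ 5))
    ×
    ¬ ((count S x₁ x₂ zm1 z1 ≡ 8) × (count S x₁ x₂ z1 z1 ≡ 6) ×
       (count S x₁ x₂ zm1 z0 ≡ 1) × (count S x₁ x₂ z0 z0 ≡ 5) ×
       (count S x₁ x₂ zm1 zm1 ≡ 8) × (count S x₁ x₂ z1 zm1 ≡ 6))
mainTheorem3 S cap x₁ x₂ indep =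
  (λ (nA , nD , nB , nO , nC , nE) → no-config-6-5 (config cap x₁ x₂ indep (≥ nA) (≥ nB) (≥ nC) (≥ nO) (≥ nD) (≥ nE))) ,
  (λ (nA , nD , nB , nO , nC , nE) → no-config-5-6 (config cap x₁ x₂ indep (≥ nA) (≥ nB) (≥ nC) (≥ nO) (≥ nD) (≥ nE)))
  where
  ≥ : ∀ {m n} → m ≡ n → n ≤ m
  ≥ m≡n = ≤-reflexive (sym m≡n)
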